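{- Let $1\le m\le n$. Let $\lambda=(\lambda_1,\ldots,\lambda_n)$ be a partition of $n(n-1)$ with $n-1\le\ell(\lambda)\le n$ and $\lambda_1=\lambda_2=\cdots=\lambda_m=2n-m-1$. Then $$\langle a_{\delta_n}^2,s_\lambda\rangle=\langle a_{\delta_m}^2,s_{\langle (m-1)^m\rangle}\rangle\cdot\langle a_{\delta_{n-m}}^2,s_{(\lambda_{m+1},\lambda_{m+2},\ldots,\lambda_n)}\rangle.$$
   Context: $\ell(\lambda)$ is the number of nonzero parts. $\langle (m-1)^m\rangle$ denotes the partition with $m$ parts all equal to $m-1$. $a_{\delta_p}=\prod_{1\le i<j\le p}(x_i-x_j)$ is the Vandermonde determinant in $x_1,\ldots,x_p$ (with $a_{\delta_0}=a_{\delta_1}=1$). For a symmetric polynomial $f$ in $p$ variables and a partition $\nu$ with at most $p$ parts (parts allowed to be $0$), $\langle f,s_\nu\rangle$ is the coefficient of the Schur polynomial $s_\nu(x_1,\ldots,x_p)$ in the Schur expansion of $f$; for $p=0$ the empty partition has coefficient $1$ in $a_{\delta_0}^2=1$. -}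

module Defs where

open import Data.Nat as ℕ using (ℕ; zero; suc; _≤_; _<_; _∸_; _≟_; _≤?_)
open import Data.Integer as ℤ using (ℤ; +_; -_)
open import Data.Fin as F using (Fin; toℕ)
open import Data.Vec as Vec using (Vec; []; _∷_; lookup; tabulate; init; last; zipWith; replicate)
open import Data.Vec.Properties using (≡-dec)
open import Data.List as List using (List; []; _∷_; [_]; concatMap; map; upTo; foldr)
open import Data.Product using (_×_; _,_)
import Relation.Nullary
open import Relation.Nullary using (yes; no)
open import Relation.Binary.PropositionalEquality using (_≡_)

-- Polynomials in p variables x_0 … x_{p-1} over ℤ, as finite lists of
-- terms (coefficient , exponent vector).  Two lists denote the same
-- polynomial iff they have the same `coeff` function.

Poly : ℕ → Set
Poly p = List (ℤ × Vec ℕ p)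

sumℕ : List ℕ → ℕ
sumℕ = foldr ℕ._+_ 0

sumℤ : List ℤ → ℤ
sumℤ = foldr ℤ._+_ (+ 0)

coeff : ∀ {p} → Poly p → Vec ℕ p → ℤ
coeff [] α = + 0
coeff ((c , β) ∷ f) α with ≡-dec _≟_ β α
... | yes _ = c ℤ.+ coeff f α
... | no  _ = coeff f α

_+P_ : ∀ {p} → Poly p → Poly p → Poly p
f +P g = f List.++ g

_*P_ : ∀ {p} → Poly p → Poly p → Poly p
f *P g = concatMap (λ { (c , β) → map (λ { (d , γ) → (c ℤ.* d , zipWith ℕ._+_ β γ) }) g }) f

negP : ∀ {p} → Poly p → Poly p
negP = map (λ { (c , β) → (- c , β) })

oneP : ∀ {p} → Poly p
oneP = [ (+ 1 , replicate _ 0) ]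

var : ∀ {p} → Fin p → Poly p
var i = [ (+ 1 , tabulate (λ k → δ (k F.≟ i))) ]
  where
  δ : ∀ {P : Set} → Relation.Nullary.Dec P → ℕ
  δ (yes _) = 1
  δ (no _)  = 0

shiftP : ∀ {p} → Poly p → Poly (suc p)
shiftP = map (λ { (c , β) → (c , 0 ∷ β) })

prodP : ∀ {p} → List (Poly p) → Poly p
prodP = foldr _*P_ oneP

-- Vandermonde a_{δ_p} = ∏_{0 ≤ i < j < p} (x_i - x_j), via
-- a_{δ_{p+1}}(x_0..x_p) = ∏_{j=1}^{p} (x_0 - x_j) · a_{δ_p}(x_1..x_p)
vandermonde : (p : ℕ) → Poly p
vandermonde zero = oneP
vandermonde (suc p) =
  prodP (map (λ j → var F.zero +P negP (var (F.suc j))) (List.allFin p))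
    *P shiftP (vandermonde p)

-- weakly decreasing vector of naturals (a partition with ≤ p parts, zeros allowed)
IsPartition : ∀ {p} → Vec ℕ p → Set
IsPartition {p} ν = (i j : Fin p) → toℕ i ≤ toℕ j → lookup ν j ≤ lookup ν i

len : ∀ {p} → Vec ℕ p → ℕ
len [] = 0
len (zero ∷ ν) = len ν
len (suc _ ∷ ν) = suc (len ν)

range : ℕ → ℕ → List ℕ
range a b = map (a ℕ.+_) (upTo (suc (b ∸ a)))

partitionsB : (p bound d : ℕ) → List (Vec ℕ p)
partitionsB zero bound zero = [ [] ]
partitionsB zero bound (suc d) = []
partitionsB (suc p) bound d =
  concatMap (λ a → map (a ∷_) (partitionsB p a (d ∸ a))) (List.filter (_≤? d) (upTo (suc bound)))

partitions : (p d : ℕ) → List (Vec ℕ p)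
partitions p d = partitionsB p d d

-- all μ (with one part fewer) interlacing the partition ν:
-- ν₁ ≥ μ₁ ≥ ν₂ ≥ μ₂ ≥ … ≥ μ_{p} ≥ ν_{p+1}, i.e. ν/μ a horizontal strip
interlacing : ∀ {k} → Vec ℕ (suc k) → List (Vec ℕ k)
interlacing (a ∷ []) = [ [] ]
interlacing (a ∷ b ∷ ν) = concatMap (λ m → map (m ∷_) (interlacing (b ∷ ν))) (range b a)

-- Kostka number K_{ν,α}: the number of semistandard Young tableaux of shape ν
-- with entries in {1..p} and content α (α_i entries equal to i).  Computed by
-- removing the horizontal strip of the largest entries p.
-- This is the coefficient of x^α in the Schur polynomial s_ν(x_1..x_p).
kostka : (p : ℕ) → Vec ℕ p → Vec ℕ p → ℕ
kostka zero [] [] = 1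
kostka (suc k) ν α =
  sumℕ (map help (interlacing ν))
  where
  help : Vec ℕ k → ℕ
  help μ with Vec.sum ν ≟ Vec.sum μ ℕ.+ last α
  ... | yes _ = kostka k μ (init α)
  ... | no _  = 0

schurCoeff : ∀ {p} → Vec ℕ p → Vec ℕ p → ℤ
schurCoeff {p} ν α = + kostka p ν α

-- c is the Schur expansion of f:  f = Σ_ν c(ν) s_ν(x_1..x_p), ν ranging over
-- partitions with ≤ p parts (values of c at non-partitions are irrelevant).
-- Compared coefficientwise: only ν with |ν| = |α| contribute to x^α.
IsSchurExpansion : (p : ℕ) → Poly p → (Vec ℕ p → ℤ) → Set
IsSchurExpansion p f c =
  (α : Vec ℕ p) →
  coeff f α ≡ sumℤ (map (λ ν → c ν ℤ.* schurCoeff ν α) (partitions p (Vec.sum α)))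

module Submission where

-- Split the variables as x = (x₁…x_m) and y = (y₁…y_k).  Since
-- a_{δ_n} = a_{δ_m}(x) · a_{δ_k}(y) · ∏ (x_i - y_t), the x-degree of a_{δ_n}² is
-- at most W = 2·(deg a_{δ_m} + m·k), and its part of x-degree W is
-- (x₁⋯x_m)^{2k} a_{δ_m}(x)² · a_{δ_k}(y)².  On the Schur side, for a partition
-- A ++ B the Kostka number K_{A++B}(β ++ γ) vanishes if |β| > |A| and equals
-- K_A(β) · K_B(γ) if |β| = |A|, while K_{μ+c}(β) = K_μ(β - c).  Comparing both
-- sides in top x-degree, and using that Schur polynomials are linearly
-- independent (Kostka matrices are unitriangular), gives
-- cₙ(A ++ B) = cₘ(A - 2k) · cₖ(B) whenever |A| = W.  The first block of λ is the
-- rectangle (m - 1 + 2k)^m, of size exactly W.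

open import Defs
open import Data.Nat as ℕ using (ℕ; zero; suc; _∸_; _≤_; _<_; z≤n; s≤s)
import Data.Nat.Properties as ℕP
import Data.Nat.Tactic.RingSolver as ℕSolver
import Data.Nat.ListAction.Properties as ℕListP
open import Data.Integer as ℤ using (ℤ; +_; -_; _+_; _*_; _-_)
import Data.Integer.Properties as ℤP
open import Data.Integer.Tactic.RingSolver using (solve-∀)
open import Data.Fin as F using (Fin; _↑ˡ_; _↑ʳ_)
open import Data.Vec as Vec using (Vec; []; _∷_; replicate; toList)
import Data.Vec.Properties as VP
open import Data.Vec.Relation.Binary.Pointwise.Inductive as PW using (Pointwise; []; _∷_)
open import Data.List as List using (List; []; _∷_; map; concatMap; foldr; _++_; [_]; upTo; length; filter)
import Data.List.Properties as LP
open import Data.List.Membership.Propositional using (_∈_; find)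
open import Data.List.Membership.Propositional.Properties using (∈-concatMap⁻; ∈-map⁻; ∈-upTo⁻; ∈-filter⁻)
open import Data.List.Relation.Unary.Any using (here; there)
open import Data.List.Relation.Unary.All using (All; []; _∷_; all?)
open import Data.Product using (_×_; _,_; proj₁; proj₂; Σ; ∃)
open import Data.Sum using (_⊎_; inj₁; inj₂)
open import Data.Unit using (⊤; tt)
open import Data.Empty using (⊥; ⊥-elim)
open import Relation.Nullary using (Dec; yes; no; ¬_; _×-dec_)
open import Relation.Unary using (Pred; Decidable)
open import Relation.Binary.PropositionalEquality hiding ([_])
open import Function using (_∘_)

∑ : {A : Set} → List A → (A → ℤ) → ℤ
∑ L g = sumℤ (map g L)

infix 5 ∑
syntax ∑ L (λ x → g) = ∑[ x ∈ L ] g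

∑-++ : {A : Set} (xs ys : List A) (g : A → ℤ) → ∑ (xs ++ ys) g ≡ ∑ xs g + ∑ ys g
∑-++ [] ys g = sym (ℤP.+-identityˡ _)
∑-++ (x ∷ xs) ys g = trans (cong (_+_ (g x)) (∑-++ xs ys g)) (sym (ℤP.+-assoc (g x) _ _))

∑-map : {A B : Set} (f : A → B) (L : List A) (g : B → ℤ) → ∑ (map f L) g ≡ ∑[ x ∈ L ] g (f x)
∑-map f [] g = refl
∑-map f (x ∷ L) g = cong (_+_ (g (f x))) (∑-map f L g)

∑-concatMap : {A B : Set} (f : A → List B) (L : List A) (g : B → ℤ) →
  ∑ (concatMap f L) g ≡ ∑[ x ∈ L ] ∑ (f x) g
∑-concatMap f [] g = refl
∑-concatMap f (x ∷ L) g = trans (∑-++ (f x) (concatMap f L) g) (cong (_+_ (∑ (f x) g)) (∑-concatMap f L g))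

∑-cong : {A : Set} (L : List A) {g h : A → ℤ} → (∀ {x} → x ∈ L → g x ≡ h x) → ∑ L g ≡ ∑ L h
∑-cong [] e = refl
∑-cong (x ∷ L) e = cong₂ _+_ (e (here refl)) (∑-cong L (e ∘ there))

∑-cong′ : {A : Set} (L : List A) {g h : A → ℤ} → (∀ x → g x ≡ h x) → ∑ L g ≡ ∑ L h
∑-cong′ L e = ∑-cong L (λ {x} _ → e x)

∑-zero : {A : Set} (L : List A) {g : A → ℤ} → (∀ {x} → x ∈ L → g x ≡ + 0) → ∑ L g ≡ + 0
∑-zero L e = trans (∑-cong L e) (∑-const0 L)
  where
  ∑-const0 : {A : Set} (L : List A) → ∑[ x ∈ L ] + 0 ≡ + 0
  ∑-const0 [] = refl
  ∑-const0 (x ∷ L) = trans (ℤP.+-identityˡ _) (∑-const0 L)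

∑-+ : {A : Set} (L : List A) (g h : A → ℤ) → ∑[ x ∈ L ] (g x + h x) ≡ ∑ L g + ∑ L h
∑-+ [] g h = refl
∑-+ (x ∷ L) g h = trans (cong (_+_ (g x + h x)) (∑-+ L g h)) (interchange (g x) (h x) (∑ L g) (∑ L h))
  where
  interchange : ∀ a b c d → a + b + (c + d) ≡ a + c + (b + d)
  interchange = solve-∀

∑-neg : {A : Set} (L : List A) (g : A → ℤ) → ∑[ x ∈ L ] - g x ≡ - ∑ L g
∑-neg [] g = refl
∑-neg (x ∷ L) g = trans (cong (_+_ (- g x)) (∑-neg L g)) (sym (ℤP.neg-distrib-+ (g x) (∑ L g)))

∑-*ˡ : {A : Set} (L : List A) (c : ℤ) (g : A → ℤ) → ∑[ x ∈ L ] (c * g x) ≡ c * ∑ L g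
∑-*ˡ [] c g = sym (ℤP.*-zeroʳ c)
∑-*ˡ (x ∷ L) c g = trans (cong (_+_ (c * g x)) (∑-*ˡ L c g)) (sym (ℤP.*-distribˡ-+ c (g x) (∑ L g)))

∑-*ʳ : {A : Set} (L : List A) (c : ℤ) (g : A → ℤ) → ∑[ x ∈ L ] (g x * c) ≡ ∑ L g * c
∑-*ʳ L c g = trans (∑-cong′ L (λ x → ℤP.*-comm (g x) c)) (trans (∑-*ˡ L c g) (ℤP.*-comm c _))

∑-- : {A : Set} (L : List A) (g h : A → ℤ) → ∑[ x ∈ L ] (g x - h x) ≡ ∑ L g - ∑ L h
∑-- L g h = trans (∑-+ L g (λ x → - h x)) (cong (_+_ (∑ L g)) (∑-neg L h))

∑-swap : {A B : Set} (L : List A) (M : List B) (g : A → B → ℤ) →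
  ∑[ x ∈ L ] ∑[ y ∈ M ] g x y ≡ ∑[ y ∈ M ] ∑[ x ∈ L ] g x y
∑-swap [] M g = sym (∑-zero M (λ _ → refl))
∑-swap (x ∷ L) M g = trans (cong (_+_ (∑ M (g x))) (∑-swap L M g)) (sym (∑-+ M (g x) (λ y → ∑[ x′ ∈ L ] g x′ y)))

∑-product : {A B : Set} (L : List A) (M : List B) (g : A → ℤ) (h : B → ℤ) →
  ∑ L g * ∑ M h ≡ ∑[ x ∈ L ] ∑[ y ∈ M ] (g x * h y)
∑-product L M g h = trans (sym (∑-*ʳ L (∑ M h) g)) (∑-cong′ L (λ x → sym (∑-*ˡ M (g x) h)))

∑-nonzero : {A : Set} (L : List A) (g : A → ℤ) → ¬ ∑ L g ≡ + 0 → ∃ λ x → x ∈ L × ¬ g x ≡ + 0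
∑-nonzero [] g nz = ⊥-elim (nz refl)
∑-nonzero (x ∷ L) g nz with g x ℤ.≟ + 0
... | no gx≢0 = x , here refl , gx≢0
... | yes gx≡0 with ∑-nonzero L g (λ e → nz (trans (cong (_+ ∑ L g) gx≡0) (trans (ℤP.+-identityˡ _) e)))
...   | y , y∈L , gy≢0 = y , there y∈L , gy≢0

when : {P : Set} → Dec P → ℤ → ℤ
when (yes _) z = z
when (no _) z = + 0

𝟙 : {P : Set} → Dec P → ℤ
𝟙 d = when d (+ 1)

when-yes : {P : Set} (d : Dec P) → P → (z : ℤ) → when d z ≡ z
when-yes (yes _) _ z = refl
when-yes (no ¬p) p z = ⊥-elim (¬p p)

when-no : {P : Set} (d : Dec P) → ¬ P → (z : ℤ) → when d z ≡ + 0
when-no (yes p) ¬p z = ⊥-elim (¬p p)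
when-no (no _) ¬p z = refl

when-0 : {P : Set} (d : Dec P) → when d (+ 0) ≡ + 0
when-0 (yes _) = refl
when-0 (no _) = refl

when-⇔ : {P Q : Set} (d : Dec P) (e : Dec Q) → (P → Q) → (Q → P) → (z : ℤ) → when d z ≡ when e z
when-⇔ (yes p) e f g z = sym (when-yes e (f p) z)
when-⇔ (no ¬p) e f g z = sym (when-no e (¬p ∘ g) z)

when-× : {P Q : Set} (d : Dec P) (e : Dec Q) (z : ℤ) → when d (when e z) ≡ when (d ×-dec e) z
when-× (yes _) (yes _) z = refl
when-× (yes _) (no _) z = refl
when-× (no _) e z = refl

when-cong : {P : Set} (d : Dec P) {x y : ℤ} → (P → x ≡ y) → when d x ≡ when d y
when-cong (yes p) e = e p
when-cong (no _) e = refl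

when-zero : {P : Set} (d : Dec P) {z : ℤ} → (P → z ≡ + 0) → when d z ≡ + 0
when-zero d e = trans (when-cong d e) (when-0 d)

when-×₃ : {P Q R : Set} (d : Dec P) (e : Dec Q) (f : Dec R) (z : ℤ) →
  when d (when e (when f z)) ≡ when (d ×-dec e ×-dec f) z
when-×₃ d e f z = trans (cong (when d) (when-× e f z)) (when-× d (e ×-dec f) z)

when-*ˡ : {P : Set} (d : Dec P) (c z : ℤ) → c * when d z ≡ when d (c * z)
when-*ˡ (yes _) c z = refl
when-*ˡ (no _) c z = ℤP.*-zeroʳ c

when-*ʳ : {P : Set} (d : Dec P) (z c : ℤ) → when d z * c ≡ when d (z * c)
when-*ʳ (yes _) z c = refl
when-*ʳ (no _) z c = ℤP.*-zeroˡ c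

when-- : {P : Set} (d : Dec P) (x y : ℤ) → when d (x - y) ≡ when d x - when d y
when-- (yes _) x y = refl
when-- (no _) x y = refl

when-∑ : {P : Set} (d : Dec P) {A : Set} (L : List A) (g : A → ℤ) → ∑[ x ∈ L ] when d (g x) ≡ when d (∑ L g)
when-∑ (yes _) L g = refl
when-∑ (no _) L g = ∑-zero L (λ _ → refl)

when-nonzero : {P : Set} (d : Dec P) (z : ℤ) → ¬ when d z ≡ + 0 → P × ¬ z ≡ + 0
when-nonzero (yes p) z nz = p , nz
when-nonzero (no _) z nz = ⊥-elim (nz refl)

count : {A : Set} → ((a b : A) → Dec (a ≡ b)) → List A → A → ℤ
count _≟_ L y = ∑[ x ∈ L ] 𝟙 (y ≟ x)

∑-single : {A : Set} (_≟_ : (a b : A) → Dec (a ≡ b)) (L : List A) (a : A) (g : A → ℤ) →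
  (∀ {x} → x ∈ L → ¬ x ≡ a → g x ≡ + 0) → ∑ L g ≡ count _≟_ L a * g a
∑-single _≟_ L a g vanish = trans (∑-cong L term) (∑-*ʳ L (g a) (λ x → 𝟙 (a ≟ x)))
  where
  term : ∀ {x} → x ∈ L → g x ≡ 𝟙 (a ≟ x) * g a
  term {x} x∈L with a ≟ x
  ... | yes refl = sym (ℤP.*-identityˡ (g a))
  ... | no a≢x = vanish x∈L (a≢x ∘ sym)

∑-reindex : {X Y : Set} (_≟_ : (a b : Y) → Dec (a ≡ b)) (f : X → Y) (L : List X) (L′ : List Y) (g : Y → ℤ) →
  (∀ {x} → x ∈ L → ¬ g (f x) ≡ + 0 → count _≟_ L′ (f x) ≡ + 1) →
  (∀ {y} → y ∈ L′ → ¬ g y ≡ + 0 → ∑[ x ∈ L ] 𝟙 (f x ≟ y) ≡ + 1) →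
  ∑[ x ∈ L ] g (f x) ≡ ∑ L′ g
∑-reindex {X} {Y} _≟_ f L L′ g once preimage =
  begin
    ∑[ x ∈ L ] g (f x)                       ≡⟨ ∑-cong L spread ⟩
    ∑[ x ∈ L ] ∑[ y ∈ L′ ] (𝟙 (f x ≟ y) * g y) ≡⟨ ∑-swap L L′ _ ⟩
    ∑[ y ∈ L′ ] ∑[ x ∈ L ] (𝟙 (f x ≟ y) * g y) ≡⟨ ∑-cong L′ collect ⟩
    ∑ L′ g                                   ∎
  where
  open ≡-Reasoning
  transport : (a b : Y) → 𝟙 (a ≟ b) * g b ≡ 𝟙 (a ≟ b) * g a
  transport a b with a ≟ b
  ... | yes refl = refl
  ... | no _ = refl
  spread : ∀ {x} → x ∈ L → g (f x) ≡ ∑[ y ∈ L′ ] (𝟙 (f x ≟ y) * g y)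
  spread {x} x∈L = sym (trans (∑-cong′ L′ (transport (f x))) (trans (∑-*ʳ L′ (g (f x)) _) (weight (g (f x) ℤ.≟ + 0))))
    where
    weight : Dec (g (f x) ≡ + 0) → count _≟_ L′ (f x) * g (f x) ≡ g (f x)
    weight (yes z) = trans (cong (count _≟_ L′ (f x) *_) z) (trans (ℤP.*-zeroʳ (count _≟_ L′ (f x))) (sym z))
    weight (no nz) = trans (cong (_* g (f x)) (once x∈L nz)) (ℤP.*-identityˡ _)
  collect : ∀ {y} → y ∈ L′ → ∑[ x ∈ L ] (𝟙 (f x ≟ y) * g y) ≡ g y
  collect {y} y∈L′ with g y ℤ.≟ + 0
  ... | yes z = trans (∑-zero L (λ {x} _ → trans (cong (𝟙 (f x ≟ y) *_) z) (ℤP.*-zeroʳ (𝟙 (f x ≟ y))))) (sym z)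
  ... | no nz = trans (∑-*ʳ L (g y) _) (trans (cong (_* g y) (preimage y∈L′ nz)) (ℤP.*-identityˡ _))

infixl 6 _+ᵥ_ _∸ᵥ_
infix 4 _≤ᵥ_ _≤ᵥ?_ _≟ᵥ_

_+ᵥ_ : ∀ {p} → Vec ℕ p → Vec ℕ p → Vec ℕ p
_+ᵥ_ = Vec.zipWith ℕ._+_

_∸ᵥ_ : ∀ {p} → Vec ℕ p → Vec ℕ p → Vec ℕ p
_∸ᵥ_ = Vec.zipWith _∸_

_≤ᵥ_ : ∀ {p} → Vec ℕ p → Vec ℕ p → Set
_≤ᵥ_ = Pointwise _≤_

_≤ᵥ?_ : ∀ {p} (a b : Vec ℕ p) → Dec (a ≤ᵥ b)
_≤ᵥ?_ = PW.decidable ℕ._≤?_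

_≟ᵥ_ : ∀ {p} (a b : Vec ℕ p) → Dec (a ≡ b)
_≟ᵥ_ = VP.≡-dec ℕ._≟_

0ᵥ : ∀ {p} → Vec ℕ p
0ᵥ = replicate _ 0

replicate-+ : ∀ m k (x : ℕ) → replicate (m ℕ.+ k) x ≡ replicate m x Vec.++ replicate k x
replicate-+ zero k x = refl
replicate-+ (suc m) k x = cong (x ∷_) (replicate-+ m k x)

0≤ᵥ : ∀ {p} (α : Vec ℕ p) → 0ᵥ ≤ᵥ α
0≤ᵥ [] = []
0≤ᵥ (a ∷ α) = z≤n ∷ 0≤ᵥ α

replicate-≤ᵥ : ∀ p {x y} → x ≤ y → replicate p x ≤ᵥ replicate p y
replicate-≤ᵥ zero _ = []
replicate-≤ᵥ (suc p) x≤y = x≤y ∷ replicate-≤ᵥ p x≤y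

∸ᵥ-0 : ∀ {p} (α : Vec ℕ p) → α ∸ᵥ 0ᵥ ≡ α
∸ᵥ-0 [] = refl
∸ᵥ-0 (a ∷ α) = cong (a ∷_) (∸ᵥ-0 α)

+ᵥ-split : ∀ {p} (β γ α : Vec ℕ p) → β +ᵥ γ ≡ α → β ≤ᵥ α × γ ≡ α ∸ᵥ β
+ᵥ-split [] [] [] e = [] , refl
+ᵥ-split (b ∷ β) (c ∷ γ) (a ∷ α) e with VP.∷-injective e
... | b+c≡a , rest with +ᵥ-split β γ α rest
... | β≤α , γ≡ = subst (b ≤_) b+c≡a (ℕP.m≤m+n b c) ∷ β≤α ,
                 cong₂ _∷_ (trans (sym (ℕP.m+n∸m≡n b c)) (cong (_∸ b) b+c≡a)) γ≡

+ᵥ-∸ᵥ : ∀ {p} (β α : Vec ℕ p) → β ≤ᵥ α → β +ᵥ (α ∸ᵥ β) ≡ α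
+ᵥ-∸ᵥ [] [] [] = refl
+ᵥ-∸ᵥ (b ∷ β) (a ∷ α) (b≤a ∷ β≤α) = cong₂ _∷_ (ℕP.m+[n∸m]≡n b≤a) (+ᵥ-∸ᵥ β α β≤α)

∸ᵥ-+ᵥ-cancel : ∀ {p} (δ γ : Vec ℕ p) → (δ +ᵥ γ) ∸ᵥ γ ≡ δ
∸ᵥ-+ᵥ-cancel [] [] = refl
∸ᵥ-+ᵥ-cancel (d ∷ δ) (c ∷ γ) = cong₂ _∷_ (ℕP.m+n∸n≡m d c) (∸ᵥ-+ᵥ-cancel δ γ)

∸ᵥ-+ᵥ : ∀ {p} (δ γ α : Vec ℕ p) → α ∸ᵥ (δ +ᵥ γ) ≡ (α ∸ᵥ δ) ∸ᵥ γ
∸ᵥ-+ᵥ [] [] [] = refl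
∸ᵥ-+ᵥ (d ∷ δ) (g ∷ γ) (a ∷ α) = cong₂ _∷_ (sym (ℕP.∸-+-assoc a d g)) (∸ᵥ-+ᵥ δ γ α)

+ᵥ-comm : ∀ {p} (u v : Vec ℕ p) → u +ᵥ v ≡ v +ᵥ u
+ᵥ-comm u v = VP.zipWith-comm ℕP.+-comm u v

∸ᵥ-comm : ∀ {p} (β u v : Vec ℕ p) → (β ∸ᵥ u) ∸ᵥ v ≡ (β ∸ᵥ v) ∸ᵥ u
∸ᵥ-comm β u v = trans (sym (∸ᵥ-+ᵥ u v β)) (trans (cong (β ∸ᵥ_) (+ᵥ-comm u v)) (∸ᵥ-+ᵥ v u β))

≤ᵥ-+ᵥ⁻ : ∀ {p} (δ γ α : Vec ℕ p) → δ +ᵥ γ ≤ᵥ α → δ ≤ᵥ α × γ ≤ᵥ α ∸ᵥ δ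
≤ᵥ-+ᵥ⁻ [] [] [] [] = [] , []
≤ᵥ-+ᵥ⁻ (d ∷ δ) (g ∷ γ) (a ∷ α) (d+g≤a ∷ rest) with ≤ᵥ-+ᵥ⁻ δ γ α rest
... | δ≤α , γ≤α∸δ = ℕP.≤-trans (ℕP.m≤m+n d g) d+g≤a ∷ δ≤α ,
                    subst (_≤ a ∸ d) (ℕP.m+n∸m≡n d g) (ℕP.∸-monoˡ-≤ d d+g≤a) ∷ γ≤α∸δ

≤ᵥ-+ᵥ⁺ : ∀ {p} (δ γ α : Vec ℕ p) → δ ≤ᵥ α → γ ≤ᵥ α ∸ᵥ δ → δ +ᵥ γ ≤ᵥ α
≤ᵥ-+ᵥ⁺ [] [] [] [] [] = []
≤ᵥ-+ᵥ⁺ (d ∷ δ) (g ∷ γ) (a ∷ α) (d≤a ∷ δ≤α) (g≤a∸d ∷ γ≤α∸δ) =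
  subst (d ℕ.+ g ≤_) (ℕP.m+[n∸m]≡n d≤a) (ℕP.+-monoʳ-≤ d g≤a∸d) ∷ ≤ᵥ-+ᵥ⁺ δ γ α δ≤α γ≤α∸δ

≤ᵥ-swap : ∀ {p} (β u v : Vec ℕ p) → u ≤ᵥ β → v ≤ᵥ β ∸ᵥ u → v ≤ᵥ β × u ≤ᵥ β ∸ᵥ v
≤ᵥ-swap β u v u≤β v≤β∸u = ≤ᵥ-+ᵥ⁻ v u β (subst (_≤ᵥ β) (+ᵥ-comm u v) (≤ᵥ-+ᵥ⁺ u v β u≤β v≤β∸u))

∸ᵥ-++ : ∀ {m k} (β u : Vec ℕ m) (γ v : Vec ℕ k) → (β Vec.++ γ) ∸ᵥ (u Vec.++ v) ≡ (β ∸ᵥ u) Vec.++ (γ ∸ᵥ v)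
∸ᵥ-++ β u γ v = VP.zipWith-++ _∸_ β γ u v

sum-+ᵥ : ∀ {p} (β γ : Vec ℕ p) → Vec.sum (β +ᵥ γ) ≡ Vec.sum β ℕ.+ Vec.sum γ
sum-+ᵥ [] [] = refl
sum-+ᵥ (b ∷ β) (c ∷ γ) = trans (cong (b ℕ.+ c ℕ.+_) (sum-+ᵥ β γ)) (interchange b c (Vec.sum β) (Vec.sum γ))
  where
  interchange : ∀ a b c d → a ℕ.+ b ℕ.+ (c ℕ.+ d) ≡ a ℕ.+ c ℕ.+ (b ℕ.+ d)
  interchange = ℕSolver.solve-∀

sum-∸ᵥ : ∀ {p} (u β : Vec ℕ p) → u ≤ᵥ β → Vec.sum (β ∸ᵥ u) ℕ.+ Vec.sum u ≡ Vec.sum β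
sum-∸ᵥ u β u≤β = trans (sym (sum-+ᵥ (β ∸ᵥ u) u)) (cong Vec.sum (trans (+ᵥ-comm (β ∸ᵥ u) u) (+ᵥ-∸ᵥ u β u≤β)))

sum-replicate : ∀ m c → Vec.sum (replicate m c) ≡ m ℕ.* c
sum-replicate zero c = refl
sum-replicate (suc m) c = cong (c ℕ.+_) (sum-replicate m c)

box : ∀ {p} → Vec ℕ p → List (Vec ℕ p)
box [] = [ [] ]
box (a ∷ α) = concatMap (λ i → map (i ∷_) (box α)) (upTo (suc a))

box-sound : ∀ {p} (α δ : Vec ℕ p) → δ ∈ box α → δ ≤ᵥ α
box-sound [] [] _ = []
box-sound (a ∷ α) δ δ∈ with find (∈-concatMap⁻ (λ i → map (i ∷_) (box α)) {xs = upTo (suc a)} δ∈)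
... | i , i∈ , δ∈′ with ∈-map⁻ (i ∷_) δ∈′
... | δ′ , δ′∈ , refl = ℕP.≤-pred (∈-upTo⁻ i∈) ∷ box-sound α δ′ δ′∈

∑-upTo-suc : ∀ (g : ℕ → ℤ) n → ∑ (upTo (suc n)) g ≡ g 0 + (∑[ i ∈ upTo n ] g (suc i))
∑-upTo-suc g n = cong (_+_ (g 0)) (trans (cong (λ L → ∑ L g) (sym (LP.map-upTo suc n))) (∑-map suc (upTo n) g))

count-upTo : ∀ b a (z : ℤ) → ∑[ i ∈ upTo (suc a) ] when (b ℕ.≟ i) z ≡ when (b ℕ.≤? a) z
count-upTo zero a z = trans (∑-upTo-suc (λ i → when (0 ℕ.≟ i) z) a)
                            (trans (cong (_+_ z) (∑-zero (upTo a) (λ _ → refl))) (ℤP.+-identityʳ z))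
count-upTo (suc b) zero z = refl
count-upTo (suc b) (suc a) z =
  trans (∑-upTo-suc (λ i → when (suc b ℕ.≟ i) z) (suc a))
   (trans (ℤP.+-identityˡ _)
    (trans (∑-cong′ (upTo (suc a)) (λ i → when-⇔ (suc b ℕ.≟ suc i) (b ℕ.≟ i) ℕP.suc-injective (cong suc) z))
     (trans (count-upTo b a z) (when-⇔ (b ℕ.≤? a) (suc b ℕ.≤? suc a) s≤s ℕP.≤-pred z))))

when-∷≟ : ∀ {p} b i (β δ : Vec ℕ p) z → when ((b ∷ β) ≟ᵥ (i ∷ δ)) z ≡ when (b ℕ.≟ i) (when (β ≟ᵥ δ) z)
when-∷≟ b i β δ z with b ℕ.≟ i | β ≟ᵥ δ
... | yes _ | yes _ = refl
... | yes _ | no _ = refl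
... | no _ | _ = refl

when-∷≤ : ∀ {p} b a (β α : Vec ℕ p) z → when ((b ∷ β) ≤ᵥ? (a ∷ α)) z ≡ when (b ℕ.≤? a) (when (β ≤ᵥ? α) z)
when-∷≤ b a β α z with b ℕ.≤? a | β ≤ᵥ? α
... | yes _ | yes _ = refl
... | yes _ | no _ = refl
... | no _ | _ = refl

count-box : ∀ {p} (β α : Vec ℕ p) (z : ℤ) → ∑[ δ ∈ box α ] when (β ≟ᵥ δ) z ≡ when (β ≤ᵥ? α) z
count-box [] [] z = ℤP.+-identityʳ z
count-box (b ∷ β) (a ∷ α) z =
  trans (∑-concatMap (λ i → map (i ∷_) (box α)) (upTo (suc a)) _)
   (trans (∑-cong′ (upTo (suc a)) row)
    (trans (count-upTo b a (when (β ≤ᵥ? α) z)) (sym (when-∷≤ b a β α z))))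
  where
  row : ∀ i → ∑[ δ ∈ map (i ∷_) (box α) ] when ((b ∷ β) ≟ᵥ δ) z ≡ when (b ℕ.≟ i) (when (β ≤ᵥ? α) z)
  row i = trans (∑-map (i ∷_) (box α) _)
           (trans (∑-cong′ (box α) (λ δ → when-∷≟ b i β δ z))
            (trans (when-∑ (b ℕ.≟ i) (box α) _) (cong (when (b ℕ.≟ i)) (count-box β α z))))

∑-box-++ : ∀ {m k} (β : Vec ℕ m) (γ : Vec ℕ k) (g : Vec ℕ (m ℕ.+ k) → ℤ) →
  ∑ (box (β Vec.++ γ)) g ≡ ∑[ β′ ∈ box β ] ∑[ γ′ ∈ box γ ] g (β′ Vec.++ γ′)
∑-box-++ [] γ g = sym (ℤP.+-identityʳ _)
∑-box-++ (b ∷ β) γ g =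
  trans (∑-concatMap (λ i → map (i ∷_) (box (β Vec.++ γ))) (upTo (suc b)) g)
   (trans (∑-cong′ (upTo (suc b)) (λ i → trans (∑-map (i ∷_) (box (β Vec.++ γ)) g) (∑-box-++ β γ (λ v → g (i ∷ v)))))
    (sym (trans (∑-concatMap (λ i → map (i ∷_) (box β)) (upTo (suc b)) _)
               (∑-cong′ (upTo (suc b)) (λ i → ∑-map (i ∷_) (box β) _)))))

coeff-++ : ∀ {p} (f g : Poly p) α → coeff (f ++ g) α ≡ coeff f α + coeff g α
coeff-++ [] g α = sym (ℤP.+-identityˡ _)
coeff-++ ((c , β) ∷ f) g α with β ≟ᵥ α
... | yes _ = trans (cong (_+_ c) (coeff-++ f g α)) (sym (ℤP.+-assoc c _ _))
... | no _ = coeff-++ f g α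

coeff-∷ : ∀ {p} c β (f : Poly p) α → coeff ((c , β) ∷ f) α ≡ when (β ≟ᵥ α) c + coeff f α
coeff-∷ c β f α with β ≟ᵥ α
... | yes _ = refl
... | no _ = sym (ℤP.+-identityˡ _)

coeff-term* : ∀ {p} (c : ℤ) (β : Vec ℕ p) (g : Poly p) (α : Vec ℕ p) →
  coeff (map (λ { (d , γ) → (c * d , β +ᵥ γ) }) g) α ≡ c * when (β ≤ᵥ? α) (coeff g (α ∸ᵥ β))
coeff-term* c β [] α = sym (trans (cong (c *_) (when-0 (β ≤ᵥ? α))) (ℤP.*-zeroʳ c))
coeff-term* c β ((d , γ) ∷ g) α =
  trans (coeff-∷ (c * d) (β +ᵥ γ) _ α)
   (trans (cong (_+_ (when (β +ᵥ γ ≟ᵥ α) (c * d))) (coeff-term* c β g α))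
    (trans (head-term (β +ᵥ γ ≟ᵥ α) (β ≤ᵥ? α) (γ ≟ᵥ α ∸ᵥ β))
     (cong (λ z → c * when (β ≤ᵥ? α) z) (sym (coeff-∷ d γ g (α ∸ᵥ β))))))
  where
  rest = coeff g (α ∸ᵥ β)
  head-term : (e : Dec (β +ᵥ γ ≡ α)) (l : Dec (β ≤ᵥ α)) (e′ : Dec (γ ≡ α ∸ᵥ β)) →
    when e (c * d) + c * when l rest ≡ c * when l (when e′ d + rest)
  head-term (yes e) (yes _) (yes _) = sym (ℤP.*-distribˡ-+ c d rest)
  head-term (yes e) (yes _) (no ≢) = ⊥-elim (≢ (proj₂ (+ᵥ-split β γ α e)))
  head-term (yes e) (no ≰) _ = ⊥-elim (≰ (proj₁ (+ᵥ-split β γ α e)))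
  head-term (no ≢) (yes β≤α) (yes e′) = ⊥-elim (≢ (trans (cong (β +ᵥ_) e′) (+ᵥ-∸ᵥ β α β≤α)))
  head-term (no _) (yes _) (no _) = trans (ℤP.+-identityˡ _) (cong (c *_) (sym (ℤP.+-identityˡ rest)))
  head-term (no _) (no _) _ = ℤP.+-identityˡ _

coeff-* : ∀ {p} (f g : Poly p) (α : Vec ℕ p) →
  coeff (f *P g) α ≡ ∑[ t ∈ f ] (proj₁ t * when (proj₂ t ≤ᵥ? α) (coeff g (α ∸ᵥ proj₂ t)))
coeff-* [] g α = refl
coeff-* ((c , β) ∷ f) g α =
  trans (coeff-++ (map _ g) (f *P g) α) (cong₂ _+_ (coeff-term* c β g α) (coeff-* f g α))

coeff-*-congʳ : ∀ {p} (f g g′ : Poly p) → (∀ α → coeff g α ≡ coeff g′ α) → ∀ α → coeff (f *P g) α ≡ coeff (f *P g′) α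
coeff-*-congʳ f g g′ e α =
  trans (coeff-* f g α)
   (trans (∑-cong′ f (λ t → cong (λ z → proj₁ t * when (proj₂ t ≤ᵥ? α) z) (e _))) (sym (coeff-* f g′ α)))

coeff-*-assoc : ∀ {p} (f g h : Poly p) α → coeff ((f *P g) *P h) α ≡ coeff (f *P (g *P h)) α
coeff-*-assoc f g h α =
  trans (coeff-* (f *P g) h α)
   (trans (∑-concatMap _ f _)
    (trans (∑-cong′ f (λ t → trans (∑-map _ g _) (inner t)))
     (sym (coeff-* f (g *P h) α))))
  where
  inner : ∀ t → ∑[ u ∈ g ] ((proj₁ t * proj₁ u) * when (proj₂ t +ᵥ proj₂ u ≤ᵥ? α) (coeff h (α ∸ᵥ (proj₂ t +ᵥ proj₂ u))))
             ≡ proj₁ t * when (proj₂ t ≤ᵥ? α) (coeff (g *P h) (α ∸ᵥ proj₂ t))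
  inner (e , δ) with δ ≤ᵥ? α
  ... | no δ≰α = trans (∑-zero g (λ {u} _ → vanish u)) (sym (ℤP.*-zeroʳ e))
    where
    vanish : ∀ u → (e * proj₁ u) * when (δ +ᵥ proj₂ u ≤ᵥ? α) (coeff h (α ∸ᵥ (δ +ᵥ proj₂ u))) ≡ + 0
    vanish (d , γ) = trans (cong ((e * d) *_) (when-no (δ +ᵥ γ ≤ᵥ? α) (δ≰α ∘ proj₁ ∘ ≤ᵥ-+ᵥ⁻ δ γ α) _)) (ℤP.*-zeroʳ (e * d))
  ... | yes δ≤α = trans (∑-cong′ g term) (trans (∑-*ˡ g e _) (cong (e *_) (sym (coeff-* g h (α ∸ᵥ δ)))))
    where
    term : ∀ u → (e * proj₁ u) * when (δ +ᵥ proj₂ u ≤ᵥ? α) (coeff h (α ∸ᵥ (δ +ᵥ proj₂ u)))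
          ≡ e * (proj₁ u * when (proj₂ u ≤ᵥ? α ∸ᵥ δ) (coeff h ((α ∸ᵥ δ) ∸ᵥ proj₂ u)))
    term (d , γ) rewrite ∸ᵥ-+ᵥ δ γ α =
      trans (ℤP.*-assoc e d _)
       (cong (λ z → e * (d * z)) (when-⇔ (δ +ᵥ γ ≤ᵥ? α) (γ ≤ᵥ? α ∸ᵥ δ) (proj₂ ∘ ≤ᵥ-+ᵥ⁻ δ γ α) (≤ᵥ-+ᵥ⁺ δ γ α δ≤α) _))

coeff-oneP* : ∀ {p} (g : Poly p) α → coeff (oneP *P g) α ≡ coeff g α
coeff-oneP* g α =
  trans (coeff-* oneP g α)
   (trans (ℤP.+-identityʳ _)
    (trans (ℤP.*-identityˡ _)
     (trans (when-yes (0ᵥ ≤ᵥ? α) (0≤ᵥ α) _) (cong (coeff g) (∸ᵥ-0 α)))))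

coeff-prodP* : ∀ {p} (fs : List (Poly p)) (X : Poly p) α → coeff (prodP fs *P X) α ≡ coeff (foldr _*P_ X fs) α
coeff-prodP* [] X α = coeff-oneP* X α
coeff-prodP* (φ ∷ fs) X α = trans (coeff-*-assoc φ (prodP fs) X α) (coeff-*-congʳ φ _ _ (coeff-prodP* fs X) α)

coeff-*-box : ∀ {p} (f g : Poly p) α → coeff (f *P g) α ≡ ∑[ δ ∈ box α ] (coeff f δ * coeff g (α ∸ᵥ δ))
coeff-*-box f g α = trans (coeff-* f g α) (terms-to-box f)
  where
  h : Vec ℕ _ → ℤ
  h δ = coeff g (α ∸ᵥ δ)
  terms-to-box : ∀ f → ∑[ t ∈ f ] (proj₁ t * when (proj₂ t ≤ᵥ? α) (h (proj₂ t))) ≡ ∑[ δ ∈ box α ] (coeff f δ * h δ)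
  terms-to-box [] = sym (∑-zero (box α) (λ _ → refl))
  terms-to-box ((c , β) ∷ f) =
    trans (cong₂ _+_ (when-*ˡ (β ≤ᵥ? α) c (h β)) (terms-to-box f))
     (sym (trans (∑-cong′ (box α) (λ δ → trans (cong (_* h δ) (coeff-∷ c β f δ)) (ℤP.*-distribʳ-+ (h δ) (when (β ≟ᵥ δ) c) (coeff f δ))))
           (trans (∑-+ (box α) (λ δ → when (β ≟ᵥ δ) c * h δ) (λ δ → coeff f δ * h δ))
            (cong (_+ (∑[ δ ∈ box α ] (coeff f δ * h δ)))
             (trans (∑-cong′ (box α) picked) (count-box β α (c * h β)))))))
    where
    picked : ∀ δ → when (β ≟ᵥ δ) c * h δ ≡ when (β ≟ᵥ δ) (c * h β)
    picked δ with β ≟ᵥ δ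
    ... | yes refl = refl
    ... | no _ = ℤP.*-zeroˡ (h δ)

coeff-shiftP : ∀ {p} (g : Poly p) a α → coeff (shiftP g) (a ∷ α) ≡ when (a ℕ.≟ 0) (coeff g α)
coeff-shiftP [] a α = sym (when-0 (a ℕ.≟ 0))
coeff-shiftP ((c , β) ∷ g) a α =
  trans (coeff-∷ c (0 ∷ β) (shiftP g) (a ∷ α))
   (trans (cong₂ _+_ (trans (when-∷≟ 0 a β α c) (when-⇔ (0 ℕ.≟ a) (a ℕ.≟ 0) sym sym _)) (coeff-shiftP g a α))
    (trans (sym (when-+ (a ℕ.≟ 0) _ _)) (cong (when (a ℕ.≟ 0)) (sym (coeff-∷ c β g α)))))
  where
  when-+ : {P : Set} (d : Dec P) (x y : ℤ) → when d (x + y) ≡ when d x + when d y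
  when-+ (yes _) x y = refl
  when-+ (no _) x y = refl

𝕖 : ∀ {p} → Fin p → Vec ℕ p
𝕖 {suc p} F.zero = 1 ∷ 0ᵥ
𝕖 {suc p} (F.suc i) = 0 ∷ 𝕖 i

lookup-𝕖-self : ∀ {p} (i : Fin p) → Vec.lookup (𝕖 i) i ≡ 1
lookup-𝕖-self F.zero = refl
lookup-𝕖-self (F.suc i) = lookup-𝕖-self i

lookup-𝕖-other : ∀ {p} (i j : Fin p) → ¬ j ≡ i → Vec.lookup (𝕖 i) j ≡ 0
lookup-𝕖-other F.zero F.zero j≢i = ⊥-elim (j≢i refl)
lookup-𝕖-other F.zero (F.suc j) _ = VP.lookup-replicate j 0
lookup-𝕖-other (F.suc i) F.zero _ = refl
lookup-𝕖-other (F.suc i) (F.suc j) j≢i = lookup-𝕖-other i j (j≢i ∘ cong F.suc)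

-- `var i` is a single monomial whose exponent vector tabulates an indicator
-- function (a helper local to the definition of `var`), which is obtained
-- here by unification and then identified with 𝕖 i.
var-exponent : ∀ {p} (i : Fin p) → Σ (Fin p → ℕ) λ f → var i ≡ [ (+ 1 , Vec.tabulate f) ]
var-exponent i = _ , refl

var-exponent-𝕖 : ∀ {p} (i j : Fin p) → proj₁ (var-exponent i) j ≡ Vec.lookup (𝕖 i) j
var-exponent-𝕖 i j with j F.≟ i
... | yes refl = sym (lookup-𝕖-self j)
... | no j≢i = sym (lookup-𝕖-other i j j≢i)

var-monomial : ∀ {p} (i : Fin p) → var i ≡ [ (+ 1 , 𝕖 i) ]
var-monomial i =
  trans (proj₂ (var-exponent i))
   (cong (λ v → [ (+ 1 , v) ]) (trans (VP.tabulate-cong (var-exponent-𝕖 i)) (VP.tabulate∘lookup (𝕖 i))))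

linFactor : ∀ {p} → Fin p → Poly (suc p)
linFactor j = var F.zero +P negP (var (F.suc j))

linFactor-terms : ∀ {p} (j : Fin p) → linFactor j ≡ (+ 1 , 𝕖 F.zero) ∷ (- + 1 , 𝕖 (F.suc j)) ∷ []
linFactor-terms j = cong₂ _++_ (var-monomial F.zero) (cong negP (var-monomial (F.suc j)))

linStep : ∀ {p} → (Vec ℕ (suc p) → ℤ) → Fin p → Vec ℕ (suc p) → ℤ
linStep P j (a ∷ α) = when (1 ℕ.≤? a) (P ((a ∸ 1) ∷ α)) - when (𝕖 j ≤ᵥ? α) (P (a ∷ (α ∸ᵥ 𝕖 j)))

coeff-linFactor* : ∀ {p} (j : Fin p) (g : Poly (suc p)) a α →
  coeff (linFactor j *P g) (a ∷ α) ≡ linStep (coeff g) j (a ∷ α)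
coeff-linFactor* j g a α =
  trans (cong (λ f → coeff (f *P g) (a ∷ α)) (linFactor-terms j))
   (trans (coeff-* ((+ 1 , 𝕖 F.zero) ∷ (- + 1 , 𝕖 (F.suc j)) ∷ []) g (a ∷ α))
    (cong₂ _+_ (trans (ℤP.*-identityˡ _) x₀-part)
               (trans (ℤP.+-identityʳ _) (trans (ℤP.-1*i≡-i _) (cong -_ xⱼ-part)))))
  where
  x₀-part : when (𝕖 F.zero ≤ᵥ? (a ∷ α)) (coeff g ((a ∷ α) ∸ᵥ 𝕖 F.zero)) ≡ when (1 ℕ.≤? a) (coeff g ((a ∸ 1) ∷ α))
  x₀-part rewrite ∸ᵥ-0 α = when-⇔ (𝕖 F.zero ≤ᵥ? (a ∷ α)) (1 ℕ.≤? a) PW.head (λ 1≤a → 1≤a ∷ 0≤ᵥ α) _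
  xⱼ-part : when (𝕖 (F.suc j) ≤ᵥ? (a ∷ α)) (coeff g ((a ∷ α) ∸ᵥ 𝕖 (F.suc j))) ≡ when (𝕖 j ≤ᵥ? α) (coeff g (a ∷ (α ∸ᵥ 𝕖 j)))
  xⱼ-part = when-⇔ (𝕖 (F.suc j) ≤ᵥ? (a ∷ α)) (𝕖 j ≤ᵥ? α) PW.tail (z≤n ∷_) _

Homogeneous : ∀ {p} → ℕ → Poly p → Set
Homogeneous D f = All (λ t → Vec.sum (proj₂ t) ≡ D) f

coeff-homogeneous : ∀ {p D} (f : Poly p) → Homogeneous D f → (α : Vec ℕ p) → ¬ Vec.sum α ≡ D → coeff f α ≡ + 0
coeff-homogeneous [] _ α _ = refl
coeff-homogeneous ((c , β) ∷ f) (β-deg ∷ rest) α α-deg =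
  trans (coeff-∷ c β f α)
   (cong₂ _+_ (when-no (β ≟ᵥ α) (λ β≡α → α-deg (trans (cong Vec.sum (sym β≡α)) β-deg)) c)
              (coeff-homogeneous f rest α α-deg))

homogeneous-++ : ∀ {p D} (f g : Poly p) → Homogeneous D f → Homogeneous D g → Homogeneous D (f ++ g)
homogeneous-++ [] g _ hg = hg
homogeneous-++ (t ∷ f) g (ht ∷ hf) hg = ht ∷ homogeneous-++ f g hf hg

homogeneous-* : ∀ {p a b} (f g : Poly p) → Homogeneous a f → Homogeneous b g → Homogeneous (a ℕ.+ b) (f *P g)
homogeneous-* [] g _ _ = []
homogeneous-* {a = a} {b} ((c , β) ∷ f) g (β-deg ∷ hf) hg = homogeneous-++ _ _ (scaled g hg) (homogeneous-* f g hf hg)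
  where
  scaled : ∀ g → Homogeneous b g → Homogeneous (a ℕ.+ b) (map (λ { (d , γ) → (c * d , β +ᵥ γ) }) g)
  scaled [] _ = []
  scaled ((d , γ) ∷ g) (γ-deg ∷ hg) = trans (sum-+ᵥ β γ) (cong₂ ℕ._+_ β-deg γ-deg) ∷ scaled g hg

sum-0ᵥ : ∀ p → Vec.sum (0ᵥ {p}) ≡ 0
sum-0ᵥ zero = refl
sum-0ᵥ (suc p) = sum-0ᵥ p

sum-𝕖 : ∀ {p} (i : Fin p) → Vec.sum (𝕖 i) ≡ 1
sum-𝕖 {suc p} F.zero = cong suc (sum-0ᵥ p)
sum-𝕖 (F.suc i) = sum-𝕖 i

homogeneous-prodP-linFactor : ∀ {p} (js : List (Fin p)) → Homogeneous (length js) (prodP (map linFactor js))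
homogeneous-prodP-linFactor {p} [] = sum-0ᵥ (suc p) ∷ []
homogeneous-prodP-linFactor {p} (j ∷ js) =
  homogeneous-* (linFactor j) _ (subst (Homogeneous 1) (sym (linFactor-terms j)) (sum-𝕖 (F.zero {p}) ∷ sum-𝕖 (F.suc j) ∷ []))
                (homogeneous-prodP-linFactor js)

homogeneous-shiftP : ∀ {p D} (f : Poly p) → Homogeneous D f → Homogeneous D (shiftP f)
homogeneous-shiftP [] _ = []
homogeneous-shiftP ((c , β) ∷ f) (h ∷ hs) = h ∷ homogeneous-shiftP f hs

vdeg : ℕ → ℕ
vdeg zero = 0
vdeg (suc p) = p ℕ.+ vdeg p

vandermonde-homogeneous : ∀ p → Homogeneous (vdeg p) (vandermonde p)
vandermonde-homogeneous zero = sum-0ᵥ 0 ∷ []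
vandermonde-homogeneous (suc p) =
  subst (λ D → Homogeneous (D ℕ.+ vdeg p) (vandermonde (suc p))) (LP.length-tabulate {n = p} (λ i → i))
    (homogeneous-* _ _ (homogeneous-prodP-linFactor (List.allFin p)) (homogeneous-shiftP _ (vandermonde-homogeneous p)))

vandermonde-degree : ∀ p (δ : Vec ℕ p) → ¬ coeff (vandermonde p) δ ≡ + 0 → Vec.sum δ ≡ vdeg p
vandermonde-degree p δ nz with Vec.sum δ ℕ.≟ vdeg p
... | yes e = e
... | no ne = ⊥-elim (nz (coeff-homogeneous (vandermonde p) (vandermonde-homogeneous p) δ ne))

-- Since
-- a_{δ_{m+k}} = a_{δ_m}(x) · a_{δ_k}(y) · ∏ (x_i - y_t), its degree in x is at
-- most xdeg m k = deg a_{δ_m} + m·k, and its part of top x-degree is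
-- a_{δ_m}(x) · (x₁⋯x_m)^k · a_{δ_k}(y).

xdeg : ℕ → ℕ → ℕ
xdeg m k = vdeg m ℕ.+ m ℕ.* k

xdeg-suc : ∀ m k → xdeg (suc m) k ≡ xdeg m k ℕ.+ k ℕ.+ m
xdeg-suc m k = rearrange (vdeg m) m k
  where
  rearrange : ∀ d m k → m ℕ.+ d ℕ.+ (k ℕ.+ m ℕ.* k) ≡ d ℕ.+ m ℕ.* k ℕ.+ k ℕ.+ m
  rearrange = ℕSolver.solve-∀

-- If A is the coefficient function of a polynomial G, then `raise c A` is
-- the coefficient function of (x₁⋯x_p)^c · G.
raise : ∀ {p} → ℕ → (Vec ℕ p → ℤ) → Vec ℕ p → ℤ
raise {p} c A v = when (replicate p c ≤ᵥ? v) (A (v ∸ᵥ replicate p c))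

coeff↑ : ∀ {p} → ℕ → Poly p → Vec ℕ p → ℤ
coeff↑ c G = raise c (coeff G)

coeff↑-cong : ∀ {p} c (G G′ : Poly p) → (∀ v → coeff G v ≡ coeff G′ v) → ∀ v → coeff↑ c G v ≡ coeff↑ c G′ v
coeff↑-cong c G G′ e v = cong (when _) (e _)

∸-≤-swap : ∀ m n o → n ≤ o → m ≤ o ∸ n → m ≤ o × n ≤ o ∸ m
∸-≤-swap m n o n≤o m≤o∸n =
  ℕP.≤-trans (ℕP.m≤m+n m n) m+n≤o , ℕP.m+n≤o⇒m≤o∸n n (subst (_≤ o) (ℕP.+-comm m n) m+n≤o)
  where
  m+n≤o : m ℕ.+ n ≤ o
  m+n≤o = ℕP.m≤o∸n⇒m+n≤o m n≤o m≤o∸n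

∸-comm : ∀ a b c → a ∸ b ∸ c ≡ a ∸ c ∸ b
∸-comm a b c = trans (ℕP.∸-+-assoc a b c) (trans (cong (a ∸_) (ℕP.+-comm b c)) (sym (ℕP.∸-+-assoc a c b)))

coeff↑-linStep : ∀ {p} c (G : Poly (suc p)) (j : Fin p) a β →
  coeff↑ c (linFactor j *P G) (a ∷ β) ≡ linStep (coeff↑ c G) j (a ∷ β)
coeff↑-linStep {p} c G j a β =
  trans (cong (when _) (coeff-linFactor* j G (a ∸ c) (β ∸ᵥ C)))
   (trans (when-- (c∷C ≤ᵥ? (a ∷ β)) _ _) (cong₂ _-_ x₀-term xⱼ-term))
  where
  C : Vec ℕ p
  C = replicate p c
  c∷C : Vec ℕ (suc p)
  c∷C = replicate (suc p) c
  x₀-conditions : Dec (1 ≤ a × c ≤ a ∸ 1 × C ≤ᵥ β)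
  x₀-conditions = (1 ℕ.≤? a) ×-dec (c ℕ.≤? (a ∸ 1)) ×-dec (C ≤ᵥ? β)
  xⱼ-conditions : Dec (𝕖 j ≤ᵥ β × c ≤ a × C ≤ᵥ β ∸ᵥ 𝕖 j)
  xⱼ-conditions = (𝕖 j ≤ᵥ? β) ×-dec (c ℕ.≤? a) ×-dec (C ≤ᵥ? β ∸ᵥ 𝕖 j)
  x₀-term : when (c∷C ≤ᵥ? (a ∷ β)) (when (1 ℕ.≤? (a ∸ c)) (coeff G ((a ∸ c ∸ 1) ∷ (β ∸ᵥ C))))
          ≡ when (1 ℕ.≤? a) (coeff↑ c G ((a ∸ 1) ∷ β))
  x₀-term =
    trans (when-∷≤ c a C β _)
     (trans (when-×₃ (c ℕ.≤? a) (C ≤ᵥ? β) (1 ℕ.≤? (a ∸ c)) _)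
      (trans (when-⇔ _ x₀-conditions
               (λ { (c≤a , C≤β , 1≤a∸c) → let (1≤a , c≤a∸1) = ∸-≤-swap 1 c a c≤a 1≤a∸c in 1≤a , c≤a∸1 , C≤β })
               (λ { (1≤a , c≤a∸1 , C≤β) → let (c≤a , 1≤a∸c) = ∸-≤-swap c 1 a 1≤a c≤a∸1 in c≤a , C≤β , 1≤a∸c }) _)
       (trans (cong (λ e → when x₀-conditions (coeff G (e ∷ (β ∸ᵥ C)))) (∸-comm a c 1))
        (sym (trans (cong (when (1 ℕ.≤? a)) (when-∷≤ c (a ∸ 1) C β _))
                    (when-×₃ (1 ℕ.≤? a) (c ℕ.≤? (a ∸ 1)) (C ≤ᵥ? β) (coeff G ((a ∸ 1 ∸ c) ∷ (β ∸ᵥ C)))))))))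
  xⱼ-term : when (c∷C ≤ᵥ? (a ∷ β)) (when (𝕖 j ≤ᵥ? β ∸ᵥ C) (coeff G ((a ∸ c) ∷ ((β ∸ᵥ C) ∸ᵥ 𝕖 j))))
          ≡ when (𝕖 j ≤ᵥ? β) (coeff↑ c G (a ∷ (β ∸ᵥ 𝕖 j)))
  xⱼ-term =
    trans (when-∷≤ c a C β _)
     (trans (when-×₃ (c ℕ.≤? a) (C ≤ᵥ? β) (𝕖 j ≤ᵥ? β ∸ᵥ C) _)
      (trans (when-⇔ _ xⱼ-conditions
               (λ { (c≤a , C≤β , 𝕖≤β∸C) → let (𝕖≤β , C≤β∸𝕖) = ≤ᵥ-swap β C (𝕖 j) C≤β 𝕖≤β∸C in 𝕖≤β , c≤a , C≤β∸𝕖 })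
               (λ { (𝕖≤β , c≤a , C≤β∸𝕖) → let (C≤β , 𝕖≤β∸C) = ≤ᵥ-swap β (𝕖 j) C 𝕖≤β C≤β∸𝕖 in c≤a , C≤β , 𝕖≤β∸C }) _)
       (trans (cong (λ v → when xⱼ-conditions (coeff G ((a ∸ c) ∷ v))) (∸ᵥ-comm β C (𝕖 j)))
        (sym (trans (cong (when (𝕖 j ≤ᵥ? β)) (when-∷≤ c a C (β ∸ᵥ 𝕖 j) _))
                    (when-×₃ (𝕖 j ≤ᵥ? β) (c ℕ.≤? a) (C ≤ᵥ? β ∸ᵥ 𝕖 j) (coeff G ((a ∸ c) ∷ ((β ∸ᵥ 𝕖 j) ∸ᵥ C)))))))))

coeff↑-shiftP : ∀ {p} c (G : Poly p) a β → coeff↑ c (shiftP G) (a ∷ β) ≡ when (a ℕ.≟ c) (coeff↑ c G β)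
coeff↑-shiftP {p} c G a β =
  trans (cong (when _) (coeff-shiftP G (a ∸ c) (β ∸ᵥ C)))
   (trans (when-∷≤ c a C β _)
    (trans (when-×₃ (c ℕ.≤? a) (C ≤ᵥ? β) ((a ∸ c) ℕ.≟ 0) _)
     (trans (when-⇔ _ ((a ℕ.≟ c) ×-dec (C ≤ᵥ? β))
              (λ { (c≤a , C≤β , a∸c≡0) → ℕP.≤-antisym (ℕP.m∸n≡0⇒m≤n a∸c≡0) c≤a , C≤β })
              (λ { (refl , C≤β) → ℕP.≤-refl , C≤β , ℕP.n∸n≡0 a }) _)
      (sym (when-× (a ℕ.≟ c) (C ≤ᵥ? β) _)))))
  where
  C : Vec ℕ p
  C = replicate p c

xFactors : ∀ m k → List (Poly (suc (m ℕ.+ k)))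
xFactors m k = map (λ j → linFactor (j ↑ˡ k)) (List.allFin m)

yFactors : ∀ m k → List (Poly (suc (m ℕ.+ k)))
yFactors m k = map (λ t → linFactor (m ↑ʳ t)) (List.allFin k)

length-allFin : ∀ n → length (List.allFin n) ≡ n
length-allFin n = LP.length-tabulate {n = n} (λ i → i)

tabulate-+ : ∀ {A : Set} m k (f : Fin (m ℕ.+ k) → A) →
  List.tabulate f ≡ List.tabulate (λ j → f (j ↑ˡ k)) ++ List.tabulate (λ t → f (m ↑ʳ t))
tabulate-+ zero k f = refl
tabulate-+ (suc m) k f = cong (f F.zero ∷_) (tabulate-+ m k (f ∘ F.suc))

vandermonde-suc-split : ∀ m k (w : Vec ℕ (suc (m ℕ.+ k))) →
  coeff (vandermonde (suc m ℕ.+ k)) w ≡ coeff (foldr _*P_ (foldr _*P_ (shiftP (vandermonde (m ℕ.+ k))) (yFactors m k)) (xFactors m k)) w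
vandermonde-suc-split m k w =
  trans (coeff-prodP* (map linFactor (List.allFin (m ℕ.+ k))) Z w)
   (trans (cong (λ L → coeff (foldr _*P_ Z L) w) factors-split)
          (cong (λ P → coeff P w) (LP.foldr-++ _*P_ Z (xFactors m k) (yFactors m k))))
  where
  Z : Poly (suc (m ℕ.+ k))
  Z = shiftP (vandermonde (m ℕ.+ k))
  factors-split : map linFactor (List.allFin (m ℕ.+ k)) ≡ xFactors m k ++ yFactors m k
  factors-split =
    trans (LP.map-tabulate (λ i → i) linFactor)
     (trans (tabulate-+ m k linFactor)
      (sym (cong₂ _++_ (LP.map-tabulate (λ i → i) (λ j → linFactor (j ↑ˡ k))) (LP.map-tabulate (λ i → i) (λ t → linFactor (m ↑ʳ t))))))

𝕖-↑ʳ : ∀ m {k} (t : Fin k) → 𝕖 (m ↑ʳ t) ≡ 0ᵥ {m} Vec.++ 𝕖 t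
𝕖-↑ʳ zero t = refl
𝕖-↑ʳ (suc m) t = cong (0 ∷_) (𝕖-↑ʳ m t)

𝕖-↑ˡ : ∀ {m} k (j : Fin m) → 𝕖 (j ↑ˡ k) ≡ 𝕖 j Vec.++ 0ᵥ {k}
𝕖-↑ˡ {suc m} k F.zero = cong (1 ∷_) (replicate-+ m k 0)
𝕖-↑ˡ k (F.suc j) = cong (0 ∷_) (𝕖-↑ˡ k j)

lower-x₀ : ∀ d ℓ a s → 1 ≤ a → d ℕ.+ suc ℓ < a ℕ.+ s → d ℕ.+ ℓ < a ∸ 1 ℕ.+ s
lower-x₀ d ℓ (suc a) s _ lt = ℕP.≤-pred (subst (_< suc a ℕ.+ s) (ℕP.+-suc d ℓ) lt)

lower-other : ∀ d ℓ a s s′ → d ℕ.+ suc ℓ < a ℕ.+ s → suc s′ ≡ s → d ℕ.+ ℓ < a ℕ.+ s′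
lower-other d ℓ a s s′ lt e = ℕP.≤-pred (subst₂ _<_ (ℕP.+-suc d ℓ) (trans (cong (a ℕ.+_) (sym e)) (ℕP.+-suc a s′)) lt)

sum-∸ᵥ-𝕖 : ∀ {p} (j : Fin p) (β : Vec ℕ p) → 𝕖 j ≤ᵥ β → suc (Vec.sum (β ∸ᵥ 𝕖 j)) ≡ Vec.sum β
sum-∸ᵥ-𝕖 j β le = trans (trans (ℕP.+-comm 1 _) (cong (Vec.sum (β ∸ᵥ 𝕖 j) ℕ.+_) (sym (sum-𝕖 j)))) (sum-∸ᵥ (𝕖 j) β le)

module _ (m k : ℕ) where

  coeff-yFactor* : ∀ (t : Fin k) (P : Poly (suc (m ℕ.+ k))) a (β : Vec ℕ m) (γ : Vec ℕ k) →
    coeff (linFactor (m ↑ʳ t) *P P) (a ∷ (β Vec.++ γ))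
      ≡ when (1 ℕ.≤? a) (coeff P ((a ∸ 1) ∷ (β Vec.++ γ))) - when (𝕖 t ≤ᵥ? γ) (coeff P (a ∷ (β Vec.++ (γ ∸ᵥ 𝕖 t))))
  coeff-yFactor* t P a β γ =
    trans (coeff-linFactor* (m ↑ʳ t) P a (β Vec.++ γ)) (cong (_-_ (when (1 ℕ.≤? a) (coeff P ((a ∸ 1) ∷ (β Vec.++ γ))))) y-term)
    where
    y-term : when (𝕖 (m ↑ʳ t) ≤ᵥ? β Vec.++ γ) (coeff P (a ∷ ((β Vec.++ γ) ∸ᵥ 𝕖 (m ↑ʳ t))))
           ≡ when (𝕖 t ≤ᵥ? γ) (coeff P (a ∷ (β Vec.++ (γ ∸ᵥ 𝕖 t))))
    y-term rewrite 𝕖-↑ʳ m t | ∸ᵥ-++ β 0ᵥ γ (𝕖 t) | ∸ᵥ-0 β =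
      when-⇔ (0ᵥ Vec.++ 𝕖 t ≤ᵥ? β Vec.++ γ) (𝕖 t ≤ᵥ? γ) (PW.++ʳ⁻ 0ᵥ β) (PW.++⁺ (0≤ᵥ β)) _

  coeff-xFactor* : ∀ (j : Fin m) (P : Poly (suc (m ℕ.+ k))) a (β : Vec ℕ m) (γ : Vec ℕ k) →
    coeff (linFactor (j ↑ˡ k) *P P) (a ∷ (β Vec.++ γ))
      ≡ when (1 ℕ.≤? a) (coeff P ((a ∸ 1) ∷ (β Vec.++ γ))) - when (𝕖 j ≤ᵥ? β) (coeff P (a ∷ ((β ∸ᵥ 𝕖 j) Vec.++ γ)))
  coeff-xFactor* j P a β γ =
    trans (coeff-linFactor* (j ↑ˡ k) P a (β Vec.++ γ)) (cong (_-_ (when (1 ℕ.≤? a) (coeff P ((a ∸ 1) ∷ (β Vec.++ γ))))) x-term)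
    where
    x-term : when (𝕖 (j ↑ˡ k) ≤ᵥ? β Vec.++ γ) (coeff P (a ∷ ((β Vec.++ γ) ∸ᵥ 𝕖 (j ↑ˡ k))))
           ≡ when (𝕖 j ≤ᵥ? β) (coeff P (a ∷ ((β ∸ᵥ 𝕖 j) Vec.++ γ)))
    x-term rewrite 𝕖-↑ˡ k j | ∸ᵥ-++ β (𝕖 j) γ 0ᵥ | ∸ᵥ-0 γ =
      when-⇔ (𝕖 j Vec.++ 0ᵥ ≤ᵥ? β Vec.++ γ) (𝕖 j ≤ᵥ? β) (PW.++ˡ⁻ (𝕖 j) β) (λ le → PW.++⁺ le (0≤ᵥ γ)) _

  yProduct : List (Fin k) → Poly (suc (m ℕ.+ k))
  yProduct ts = foldr _*P_ (shiftP (vandermonde (m ℕ.+ k))) (map (λ t → linFactor (m ↑ʳ t)) ts)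

  xyProduct : List (Fin m) → Poly (suc (m ℕ.+ k))
  xyProduct js = foldr _*P_ (yProduct (List.allFin k)) (map (λ j → linFactor (j ↑ˡ k)) js)

  xProduct : List (Fin m) → Poly (suc m)
  xProduct js = foldr _*P_ (shiftP (vandermonde m)) (map linFactor js)

  module _ (vanishing : ∀ (β : Vec ℕ m) (γ : Vec ℕ k) → xdeg m k < Vec.sum β → coeff (vandermonde (m ℕ.+ k)) (β Vec.++ γ) ≡ + 0) where

    yProduct-vanishing : ∀ ts a (β : Vec ℕ m) (γ : Vec ℕ k) → xdeg m k ℕ.+ length ts < a ℕ.+ Vec.sum β →
      coeff (yProduct ts) (a ∷ (β Vec.++ γ)) ≡ + 0
    yProduct-vanishing [] a β γ lt =
      trans (coeff-shiftP (vandermonde (m ℕ.+ k)) a (β Vec.++ γ))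
       (when-zero (a ℕ.≟ 0) λ { refl → vanishing β γ (subst (_< Vec.sum β) (ℕP.+-identityʳ _) lt) })
    yProduct-vanishing (t ∷ ts) a β γ lt =
      trans (coeff-yFactor* t (yProduct ts) a β γ)
       (cong₂ _-_ (when-zero (1 ℕ.≤? a) (λ 1≤a → yProduct-vanishing ts (a ∸ 1) β γ (lower-x₀ _ _ a _ 1≤a lt)))
                  (when-zero (𝕖 t ≤ᵥ? γ) (λ _ → yProduct-vanishing ts a β (γ ∸ᵥ 𝕖 t) (ℕP.<-trans (ℕP.+-monoʳ-< _ (ℕP.n<1+n _)) lt))))

    -- in top x-degree every factor x₀ - y_t contributes x₀
    yProduct-top : ∀ ts a (β : Vec ℕ m) (γ : Vec ℕ k) → a ℕ.+ Vec.sum β ≡ xdeg m k ℕ.+ length ts →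
      coeff (yProduct ts) (a ∷ (β Vec.++ γ)) ≡ when (a ℕ.≟ length ts) (coeff (vandermonde (m ℕ.+ k)) (β Vec.++ γ))
    yProduct-top [] a β γ e = coeff-shiftP (vandermonde (m ℕ.+ k)) a (β Vec.++ γ)
    yProduct-top (t ∷ ts) a β γ e =
      trans (coeff-yFactor* t (yProduct ts) a β γ)
       (trans (cong₂ _-_ (x₀-contribution a e) (when-zero (𝕖 t ≤ᵥ? γ) (λ _ → yProduct-vanishing ts a β (γ ∸ᵥ 𝕖 t) too-high)))
        (ℤP.+-identityʳ _))
      where
      ℓ : ℕ
      ℓ = length ts
      too-high : xdeg m k ℕ.+ ℓ < a ℕ.+ Vec.sum β
      too-high = subst (xdeg m k ℕ.+ ℓ <_) (sym e) (subst (_≤ xdeg m k ℕ.+ suc ℓ) (ℕP.+-suc _ _) ℕP.≤-refl)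
      x₀-contribution : ∀ a → a ℕ.+ Vec.sum β ≡ xdeg m k ℕ.+ suc ℓ →
        when (1 ℕ.≤? a) (coeff (yProduct ts) ((a ∸ 1) ∷ (β Vec.++ γ))) ≡ when (a ℕ.≟ suc ℓ) (coeff (vandermonde (m ℕ.+ k)) (β Vec.++ γ))
      x₀-contribution zero e = refl
      x₀-contribution (suc a) e =
        trans (yProduct-top ts a β γ (ℕP.suc-injective (trans e (ℕP.+-suc _ _))))
         (when-⇔ (a ℕ.≟ ℓ) (suc a ℕ.≟ suc ℓ) (cong suc) ℕP.suc-injective _)

    xyProduct-vanishing : ∀ js a (β : Vec ℕ m) (γ : Vec ℕ k) → xdeg m k ℕ.+ k ℕ.+ length js < a ℕ.+ Vec.sum β →
      coeff (xyProduct js) (a ∷ (β Vec.++ γ)) ≡ + 0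
    xyProduct-vanishing [] a β γ lt =
      yProduct-vanishing (List.allFin k) a β γ
        (subst (λ ℓ → xdeg m k ℕ.+ ℓ < a ℕ.+ Vec.sum β) (sym (length-allFin k)) (subst (_< a ℕ.+ Vec.sum β) (ℕP.+-identityʳ _) lt))
    xyProduct-vanishing (j ∷ js) a β γ lt =
      trans (coeff-xFactor* j (xyProduct js) a β γ)
       (cong₂ _-_ (when-zero (1 ℕ.≤? a) (λ 1≤a → xyProduct-vanishing js (a ∸ 1) β γ (lower-x₀ _ _ a _ 1≤a lt)))
                  (when-zero (𝕖 j ≤ᵥ? β) (λ 𝕖≤β → xyProduct-vanishing js a (β ∸ᵥ 𝕖 j) γ (lower-other _ _ a _ _ lt (sum-∸ᵥ-𝕖 j β 𝕖≤β)))))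

    module _ (top : ∀ (β : Vec ℕ m) (γ : Vec ℕ k) → Vec.sum β ≡ xdeg m k →
                 coeff (vandermonde (m ℕ.+ k)) (β Vec.++ γ) ≡ coeff↑ k (vandermonde m) β * coeff (vandermonde k) γ) where

      xyProduct-top : ∀ js a (β : Vec ℕ m) (γ : Vec ℕ k) → a ℕ.+ Vec.sum β ≡ xdeg m k ℕ.+ k ℕ.+ length js →
        coeff (xyProduct js) (a ∷ (β Vec.++ γ)) ≡ coeff↑ k (xProduct js) (a ∷ β) * coeff (vandermonde k) γ
      xyProduct-top [] a β γ e =
        trans (yProduct-top (List.allFin k) a β γ (trans e (trans (ℕP.+-identityʳ _) (cong (xdeg m k ℕ.+_) (sym (length-allFin k))))))
         (trans (when-⇔ (a ℕ.≟ length (List.allFin k)) (a ℕ.≟ k) (λ e → trans e (length-allFin k)) (λ e → trans e (sym (length-allFin k))) _)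
          (trans (when-cong (a ℕ.≟ k) (λ { refl → top β γ (ℕP.+-cancelˡ-≡ a _ _ (trans e (trans (ℕP.+-identityʳ _) (ℕP.+-comm (xdeg m k) a)))) }))
           (sym (trans (cong (_* coeff (vandermonde k) γ) (coeff↑-shiftP k (vandermonde m) a β)) (when-*ʳ (a ℕ.≟ k) _ _)))))
      xyProduct-top (j ∷ js) a β γ e =
        trans (coeff-xFactor* j (xyProduct js) a β γ)
         (trans (cong₂ _-_ (when-cong (1 ℕ.≤? a) (λ 1≤a → xyProduct-top js (a ∸ 1) β γ (lower-x₀′ 1≤a)))
                           (when-cong (𝕖 j ≤ᵥ? β) (λ 𝕖≤β → xyProduct-top js a (β ∸ᵥ 𝕖 j) γ (lower-other′ 𝕖≤β))))
          (trans (cong₂ _-_ (sym (when-*ʳ (1 ℕ.≤? a) x₀-part c)) (sym (when-*ʳ (𝕖 j ≤ᵥ? β) xⱼ-part c)))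
           (trans (factor-out (when (1 ℕ.≤? a) x₀-part) (when (𝕖 j ≤ᵥ? β) xⱼ-part) c)
            (cong (_* c) (sym (coeff↑-linStep k (xProduct js) j a β))))))
        where
        c : ℤ
        c = coeff (vandermonde k) γ
        ℓ : ℕ
        ℓ = length js
        x₀-part xⱼ-part : ℤ
        x₀-part = coeff↑ k (xProduct js) ((a ∸ 1) ∷ β)
        xⱼ-part = coeff↑ k (xProduct js) (a ∷ (β ∸ᵥ 𝕖 j))
        factor-out : ∀ x y c → x * c - y * c ≡ (x - y) * c
        factor-out = solve-∀
        lower-x₀′ : 1 ≤ a → a ∸ 1 ℕ.+ Vec.sum β ≡ xdeg m k ℕ.+ k ℕ.+ ℓ
        lower-x₀′ (s≤s _) = ℕP.suc-injective (trans e (ℕP.+-suc _ ℓ))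
        lower-other′ : 𝕖 j ≤ᵥ β → a ℕ.+ Vec.sum (β ∸ᵥ 𝕖 j) ≡ xdeg m k ℕ.+ k ℕ.+ ℓ
        lower-other′ 𝕖≤β = ℕP.suc-injective (trans (sym (ℕP.+-suc a _)) (trans (cong (a ℕ.+_) (sum-∸ᵥ-𝕖 j β 𝕖≤β)) (trans e (ℕP.+-suc _ ℓ))))

vandermonde-split-vanishing : ∀ m k (β : Vec ℕ m) (γ : Vec ℕ k) → xdeg m k < Vec.sum β →
  coeff (vandermonde (m ℕ.+ k)) (β Vec.++ γ) ≡ + 0
vandermonde-split-vanishing zero k [] γ ()
vandermonde-split-vanishing (suc m) k (a ∷ β) γ lt =
  trans (vandermonde-suc-split m k (a ∷ (β Vec.++ γ)))
   (xyProduct-vanishing m k (vandermonde-split-vanishing m k) (List.allFin m) a β γ (subst (_< a ℕ.+ Vec.sum β) (xdeg-suc′ m k) lt))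
  where
  xdeg-suc′ : ∀ m k → xdeg (suc m) k ≡ xdeg m k ℕ.+ k ℕ.+ length (List.allFin m)
  xdeg-suc′ m k = trans (xdeg-suc m k) (cong (xdeg m k ℕ.+ k ℕ.+_) (sym (length-allFin m)))

vandermonde-split-top : ∀ m k (β : Vec ℕ m) (γ : Vec ℕ k) → Vec.sum β ≡ xdeg m k →
  coeff (vandermonde (m ℕ.+ k)) (β Vec.++ γ) ≡ coeff↑ k (vandermonde m) β * coeff (vandermonde k) γ
vandermonde-split-top zero k [] γ e = sym (ℤP.*-identityˡ _)
vandermonde-split-top (suc m) k (a ∷ β) γ e =
  trans (vandermonde-suc-split m k (a ∷ (β Vec.++ γ)))
   (trans (xyProduct-top m k (vandermonde-split-vanishing m k) (vandermonde-split-top m k) (List.allFin m) a β γ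
            (trans e (trans (xdeg-suc m k) (cong (xdeg m k ℕ.+ k ℕ.+_) (sym (length-allFin m))))))
    (cong (_* coeff (vandermonde k) γ)
     (coeff↑-cong k (xProduct m k (List.allFin m)) (vandermonde (suc m)) (λ v → sym (coeff-prodP* (map linFactor (List.allFin m)) (shiftP (vandermonde m)) v)) (a ∷ β))))

-- Convolution of coefficient functions, and its compatibility with raising:
-- (x^C·F)(x^C·G) = x^{2C}·FG.

conv : ∀ {p} → (Vec ℕ p → ℤ) → (Vec ℕ p → ℤ) → Vec ℕ p → ℤ
conv A B β = ∑[ δ ∈ box β ] (A δ * B (β ∸ᵥ δ))

∸-shift : ∀ b d c → b ∸ (d ℕ.+ c) ∸ c ≡ b ∸ (c ℕ.+ c) ∸ d
∸-shift b d c = trans (ℕP.∸-+-assoc b (d ℕ.+ c) c) (trans (cong (b ∸_) (trans (ℕP.+-assoc d c c) (ℕP.+-comm d (c ℕ.+ c)))) (sym (ℕP.∸-+-assoc b (c ℕ.+ c) d)))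

shift-fits : ∀ b d c → c ℕ.+ c ≤ b → d ≤ b ∸ (c ℕ.+ c) → d ℕ.+ c ≤ b × c ≤ b ∸ (d ℕ.+ c)
shift-fits b d c 2c≤b d≤b∸2c =
  ℕP.≤-trans (ℕP.+-monoʳ-≤ d (ℕP.m≤n+m c c)) d+2c≤b ,
  ℕP.m+n≤o⇒m≤o∸n c (subst (_≤ b) (ℕP.+-comm (d ℕ.+ c) c) (ℕP.≤-trans (ℕP.≤-reflexive (ℕP.+-assoc d c c)) d+2c≤b))
  where
  d+2c≤b : d ℕ.+ (c ℕ.+ c) ≤ b
  d+2c≤b = ℕP.m≤o∸n⇒m+n≤o d 2c≤b d≤b∸2c

unshift-fits : ∀ b e c → e ≤ b → c ≤ e → c ≤ b ∸ e → c ℕ.+ c ≤ b × e ∸ c ≤ b ∸ (c ℕ.+ c)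
unshift-fits b e c e≤b c≤e c≤b∸e =
  ℕP.≤-trans (ℕP.+-monoˡ-≤ c c≤e) e+c≤b ,
  ℕP.m+n≤o⇒m≤o∸n (e ∸ c) (subst (_≤ b) (trans (cong (ℕ._+ c) (sym (ℕP.m∸n+n≡m c≤e))) (ℕP.+-assoc (e ∸ c) c c)) e+c≤b)
  where
  e+c≤b : e ℕ.+ c ≤ b
  e+c≤b = ℕP.≤-trans (ℕP.+-monoʳ-≤ e c≤b∸e) (ℕP.≤-reflexive (ℕP.m+[n∸m]≡n e≤b))

module _ (c : ℕ) where

  private
    C : ∀ {m} → Vec ℕ m
    C = replicate _ c
    2C : ∀ {m} → Vec ℕ m
    2C = replicate _ (c ℕ.+ c)

  ∸ᵥ-shift : ∀ {m} (β δ : Vec ℕ m) → (β ∸ᵥ (δ +ᵥ C)) ∸ᵥ C ≡ (β ∸ᵥ 2C) ∸ᵥ δ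
  ∸ᵥ-shift [] [] = refl
  ∸ᵥ-shift (b ∷ β) (d ∷ δ) = cong₂ _∷_ (∸-shift b d c) (∸ᵥ-shift β δ)

  shiftᵥ-fits : ∀ {m} (β δ : Vec ℕ m) → 2C ≤ᵥ β → δ ≤ᵥ β ∸ᵥ 2C → δ +ᵥ C ≤ᵥ β × C ≤ᵥ β ∸ᵥ (δ +ᵥ C)
  shiftᵥ-fits [] [] [] [] = [] , []
  shiftᵥ-fits (b ∷ β) (d ∷ δ) (l ∷ ls) (l′ ∷ ls′) =
    let (x₁ , x₂) = shift-fits b d c l l′ ; (y₁ , y₂) = shiftᵥ-fits β δ ls ls′ in (x₁ ∷ y₁) , (x₂ ∷ y₂)

  unshiftᵥ-fits : ∀ {m} (β e : Vec ℕ m) → e ≤ᵥ β → C ≤ᵥ e → C ≤ᵥ β ∸ᵥ e → 2C ≤ᵥ β × e ∸ᵥ C ≤ᵥ β ∸ᵥ 2C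
  unshiftᵥ-fits [] [] [] [] [] = [] , []
  unshiftᵥ-fits (b ∷ β) (x ∷ e) (l ∷ ls) (l₁ ∷ l₁s) (l₂ ∷ l₂s) =
    let (x₁ , x₂) = unshift-fits b x c l l₁ l₂ ; (y₁ , y₂) = unshiftᵥ-fits β e ls l₁s l₂s in (x₁ ∷ y₁) , (x₂ ∷ y₂)

  C≤ᵥ+C : ∀ {m} (δ : Vec ℕ m) → C ≤ᵥ δ +ᵥ C
  C≤ᵥ+C [] = []
  C≤ᵥ+C (d ∷ δ) = ℕP.m≤n+m c d ∷ C≤ᵥ+C δ

  +ᵥC≡⇔ : ∀ {m} (δ e : Vec ℕ m) → C ≤ᵥ e → (δ +ᵥ C ≡ e → e ∸ᵥ C ≡ δ) × (e ∸ᵥ C ≡ δ → δ +ᵥ C ≡ e)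
  +ᵥC≡⇔ δ e C≤e = (λ { refl → ∸ᵥ-+ᵥ-cancel δ C }) ,
                  (λ { refl → trans (+ᵥ-comm (e ∸ᵥ C) C) (+ᵥ-∸ᵥ C e C≤e) })

  conv-raise : ∀ {m} (β : Vec ℕ m) (A B : Vec ℕ m → ℤ) → conv (raise c A) (raise c B) β ≡ raise (c ℕ.+ c) (conv A B) β
  conv-raise {m} β A B with 2C ≤ᵥ? β
  ... | no 2C≰β = ∑-zero (box β) (λ {β′} β′∈ → vanish β′ (box-sound β β′ β′∈))
    where
    vanish : ∀ β′ → β′ ≤ᵥ β → raise c A β′ * raise c B (β ∸ᵥ β′) ≡ + 0
    vanish β′ β′≤β with C ≤ᵥ? β′ | C ≤ᵥ? β ∸ᵥ β′
    ... | yes C≤β′ | yes C≤β∸β′ = ⊥-elim (2C≰β (proj₁ (unshiftᵥ-fits β β′ β′≤β C≤β′ C≤β∸β′)))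
    ... | yes _ | no _ = ℤP.*-zeroʳ (A (β′ ∸ᵥ C))
    ... | no _ | _ = refl
  ... | yes 2C≤β =
    sym (trans (∑-cong (box (β ∸ᵥ 2C)) (λ {δ} δ∈ → sym (shifted-term δ (box-sound _ δ δ∈))))
               (∑-reindex _≟ᵥ_ (_+ᵥ C) (box (β ∸ᵥ 2C)) (box β) g once preimage))
    where
    g : Vec ℕ m → ℤ
    g β′ = raise c A β′ * raise c B (β ∸ᵥ β′)
    shifted-term : ∀ δ → δ ≤ᵥ β ∸ᵥ 2C → g (δ +ᵥ C) ≡ A δ * B ((β ∸ᵥ 2C) ∸ᵥ δ)
    shifted-term δ δ≤ =
      cong₂ _*_ (trans (when-yes (C ≤ᵥ? δ +ᵥ C) (C≤ᵥ+C δ) _) (cong A (∸ᵥ-+ᵥ-cancel δ C)))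
                (trans (when-yes (C ≤ᵥ? β ∸ᵥ (δ +ᵥ C)) (proj₂ (shiftᵥ-fits β δ 2C≤β δ≤)) _) (cong B (∸ᵥ-shift β δ)))
    once : ∀ {δ} → δ ∈ box (β ∸ᵥ 2C) → ¬ g (δ +ᵥ C) ≡ + 0 → count _≟ᵥ_ (box β) (δ +ᵥ C) ≡ + 1
    once {δ} δ∈ _ = trans (count-box (δ +ᵥ C) β (+ 1)) (when-yes (δ +ᵥ C ≤ᵥ? β) (proj₁ (shiftᵥ-fits β δ 2C≤β (box-sound _ δ δ∈))) (+ 1))
    preimage : ∀ {y} → y ∈ box β → ¬ g y ≡ + 0 → ∑[ δ ∈ box (β ∸ᵥ 2C) ] 𝟙 (δ +ᵥ C ≟ᵥ y) ≡ + 1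
    preimage {y} y∈ nz with C ≤ᵥ? y | C ≤ᵥ? β ∸ᵥ y
    ... | no _ | _ = ⊥-elim (nz refl)
    ... | yes _ | no _ = ⊥-elim (nz (ℤP.*-zeroʳ (A (y ∸ᵥ C))))
    ... | yes C≤y | yes C≤β∸y =
      trans (∑-cong′ (box (β ∸ᵥ 2C)) (λ δ → when-⇔ (δ +ᵥ C ≟ᵥ y) (y ∸ᵥ C ≟ᵥ δ) (proj₁ (+ᵥC≡⇔ δ y C≤y)) (proj₂ (+ᵥC≡⇔ δ y C≤y)) (+ 1)))
       (trans (count-box (y ∸ᵥ C) (β ∸ᵥ 2C) (+ 1))
        (when-yes (y ∸ᵥ C ≤ᵥ? β ∸ᵥ 2C) (proj₂ (unshiftᵥ-fits β y (box-sound β y y∈) C≤y C≤β∸y)) (+ 1)))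

square : ∀ p → Vec ℕ p → ℤ
square p = coeff (vandermonde p *P vandermonde p)

one-exceeds : ∀ a b h → h ℕ.+ h ≤ a ℕ.+ b → ¬ a ≡ h → h < a ⊎ h < b
one-exceeds a b h 2h≤a+b a≢h with h ℕ.<? a
... | yes h<a = inj₁ h<a
... | no h≮a = inj₂ (ℕP.+-cancelˡ-< a h b (ℕP.<-≤-trans (ℕP.+-monoˡ-< h (ℕP.≤∧≢⇒< (ℕP.≮⇒≥ h≮a) a≢h)) 2h≤a+b))

module _ (m k : ℕ) where

  private
    V : Vec ℕ (m ℕ.+ k) → ℤ
    V = coeff (vandermonde (m ℕ.+ k))
    h : ℕ
    h = xdeg m k
    R : Vec ℕ m → ℤ
    R = coeff↑ k (vandermonde m)

  splitTerm : Vec ℕ m → Vec ℕ m → Vec ℕ k → ℤ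
  splitTerm β β′ γ = ∑[ γ′ ∈ box γ ] (V (β′ Vec.++ γ′) * V ((β ∸ᵥ β′) Vec.++ (γ ∸ᵥ γ′)))

  square-split : ∀ (β : Vec ℕ m) (γ : Vec ℕ k) → square (m ℕ.+ k) (β Vec.++ γ) ≡ ∑[ β′ ∈ box β ] splitTerm β β′ γ
  square-split β γ =
    trans (coeff-*-box (vandermonde (m ℕ.+ k)) (vandermonde (m ℕ.+ k)) (β Vec.++ γ))
     (trans (∑-box-++ β γ (λ δ → V δ * V ((β Vec.++ γ) ∸ᵥ δ)))
      (∑-cong′ (box β) (λ β′ → ∑-cong′ (box γ) (λ γ′ → cong (λ v → V (β′ Vec.++ γ′) * V v) (∸ᵥ-++ β β′ γ γ′)))))

  splitTerm-vanishing : ∀ β β′ γ → h < Vec.sum β′ ⊎ h < Vec.sum (β ∸ᵥ β′) → splitTerm β β′ γ ≡ + 0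
  splitTerm-vanishing β β′ γ (inj₁ lt) =
    ∑-zero (box γ) (λ {γ′} _ → cong (_* V ((β ∸ᵥ β′) Vec.++ (γ ∸ᵥ γ′))) (vandermonde-split-vanishing m k β′ γ′ lt))
  splitTerm-vanishing β β′ γ (inj₂ lt) =
    ∑-zero (box γ) (λ {γ′} _ → trans (cong (V (β′ Vec.++ γ′) *_) (vandermonde-split-vanishing m k (β ∸ᵥ β′) (γ ∸ᵥ γ′) lt))
                                      (ℤP.*-zeroʳ (V (β′ Vec.++ γ′))))

  splitTerm-top : ∀ β β′ γ → Vec.sum β′ ≡ h → Vec.sum (β ∸ᵥ β′) ≡ h →
    splitTerm β β′ γ ≡ (R β′ * R (β ∸ᵥ β′)) * square k γ
  splitTerm-top β β′ γ e₁ e₂ =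
    trans (∑-cong′ (box γ) (λ γ′ → trans (cong₂ _*_ (vandermonde-split-top m k β′ γ′ e₁) (vandermonde-split-top m k (β ∸ᵥ β′) (γ ∸ᵥ γ′) e₂))
                                         (interchange (R β′) (W γ′) (R (β ∸ᵥ β′)) (W (γ ∸ᵥ γ′)))))
     (trans (∑-*ˡ (box γ) (R β′ * R (β ∸ᵥ β′)) (λ γ′ → W γ′ * W (γ ∸ᵥ γ′)))
      (cong (R β′ * R (β ∸ᵥ β′) *_) (sym (coeff-*-box (vandermonde k) (vandermonde k) γ))))
    where
    W : Vec ℕ k → ℤ
    W = coeff (vandermonde k)
    interchange : ∀ a b c d → (a * b) * (c * d) ≡ (a * c) * (b * d)
    interchange = solve-∀

  coeff↑-vandermonde-degree : ∀ β′ → ¬ Vec.sum β′ ≡ h → R β′ ≡ + 0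
  coeff↑-vandermonde-degree β′ ne = when-zero (K ≤ᵥ? β′) vanish
    where
    K : Vec ℕ m
    K = replicate m k
    vanish : K ≤ᵥ β′ → coeff (vandermonde m) (β′ ∸ᵥ K) ≡ + 0
    vanish K≤β′ with coeff (vandermonde m) (β′ ∸ᵥ K) ℤ.≟ + 0
    ... | yes z = z
    ... | no nz = ⊥-elim (ne (trans (sym (sum-∸ᵥ K β′ K≤β′))
                                   (cong₂ ℕ._+_ (vandermonde-degree m (β′ ∸ᵥ K) nz) (sum-replicate m k))))

  split-size : ∀ {β β′ : Vec ℕ m} → β′ ≤ᵥ β → Vec.sum β ≡ Vec.sum β′ ℕ.+ Vec.sum (β ∸ᵥ β′)
  split-size {β} {β′} β′≤β = trans (sym (sum-∸ᵥ β′ β β′≤β)) (ℕP.+-comm (Vec.sum (β ∸ᵥ β′)) (Vec.sum β′))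

  square-split-vanishing : ∀ (β : Vec ℕ m) (γ : Vec ℕ k) → h ℕ.+ h < Vec.sum β → square (m ℕ.+ k) (β Vec.++ γ) ≡ + 0
  square-split-vanishing β γ lt =
    trans (square-split β γ) (∑-zero (box β) (λ {β′} β′∈ → splitTerm-vanishing β β′ γ (exceeds β′ (box-sound β β′ β′∈))))
    where
    exceeds : ∀ β′ → β′ ≤ᵥ β → h < Vec.sum β′ ⊎ h < Vec.sum (β ∸ᵥ β′)
    exceeds β′ β′≤β with Vec.sum β′ ℕ.≟ h
    ... | no ≢h = one-exceeds (Vec.sum β′) (Vec.sum (β ∸ᵥ β′)) h (ℕP.<⇒≤ (subst (h ℕ.+ h <_) (split-size β′≤β) lt)) ≢h
    ... | yes ≡h = inj₂ (ℕP.+-cancelˡ-< h h (Vec.sum (β ∸ᵥ β′))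
                          (subst (h ℕ.+ h <_) (trans (split-size β′≤β) (cong (ℕ._+ Vec.sum (β ∸ᵥ β′)) ≡h)) lt))

  square-split-top : ∀ (β : Vec ℕ m) (γ : Vec ℕ k) → Vec.sum β ≡ h ℕ.+ h →
    square (m ℕ.+ k) (β Vec.++ γ) ≡ coeff↑ (k ℕ.+ k) (vandermonde m *P vandermonde m) β * square k γ
  square-split-top β γ e =
    trans (square-split β γ)
     (trans (∑-cong (box β) (λ {β′} β′∈ → term β′ (box-sound β β′ β′∈)))
      (trans (∑-*ʳ (box β) (square k γ) (λ β′ → R β′ * R (β ∸ᵥ β′)))
       (cong (_* square k γ)
        (trans (conv-raise k β (coeff (vandermonde m)) (coeff (vandermonde m)))
         (cong (when (replicate m (k ℕ.+ k) ≤ᵥ? β)) (sym (coeff-*-box (vandermonde m) (vandermonde m) (β ∸ᵥ replicate m (k ℕ.+ k)))))))))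
    where
    term : ∀ β′ → β′ ≤ᵥ β → splitTerm β β′ γ ≡ (R β′ * R (β ∸ᵥ β′)) * square k γ
    term β′ β′≤β with Vec.sum β′ ℕ.≟ h
    ... | yes ≡h = splitTerm-top β β′ γ ≡h (ℕP.+-cancelˡ-≡ h _ _ (trans (cong (ℕ._+ Vec.sum (β ∸ᵥ β′)) (sym ≡h)) (trans (sym (split-size β′≤β)) e)))
    ... | no ≢h =
      trans (splitTerm-vanishing β β′ γ (one-exceeds (Vec.sum β′) (Vec.sum (β ∸ᵥ β′)) h (ℕP.≤-reflexive (trans (sym e) (split-size β′≤β))) ≢h))
       (sym (cong (λ z → (z * R (β ∸ᵥ β′)) * square k γ) (coeff↑-vandermonde-degree β′ ≢h)))

-- The recursion of `kostka` removes the last entry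
-- of the content and a horizontal strip from the shape; to split shapes and
-- contents into blocks it is convenient to transport it to lists, where
-- lengths are not indices.

lastOr0 : List ℕ → ℕ
lastOr0 [] = 0
lastOr0 (x ∷ []) = x
lastOr0 (x ∷ y ∷ xs) = lastOr0 (y ∷ xs)

dropLast : List ℕ → List ℕ
dropLast [] = []
dropLast (x ∷ []) = []
dropLast (x ∷ y ∷ xs) = x ∷ dropLast (y ∷ xs)

interlacingL : List ℕ → List (List ℕ)
interlacingL [] = []
interlacingL (a ∷ []) = [ [] ]
interlacingL (a ∷ b ∷ ν) = concatMap (λ x → map (x ∷_) (interlacingL (b ∷ ν))) (range b a)

kostkaL : ℕ → List ℕ → List ℕ → ℤ
kostkaL zero ν α = + 1
kostkaL (suc p) ν α =
  ∑[ μ ∈ interlacingL ν ] when (sumℕ ν ℕ.≟ sumℕ μ ℕ.+ lastOr0 α) (kostkaL p μ (dropLast α))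

-- The summand of `kostka` is a helper local to its definition; we obtain it
-- by unification and compute it.
kostka-unfold : ∀ k (ν α : Vec ℕ (suc k)) → Σ (Vec ℕ k → ℕ) λ term → kostka (suc k) ν α ≡ sumℕ (map term (interlacing ν))
kostka-unfold k ν α = _ , refl

kostka-term : ∀ k (ν α : Vec ℕ (suc k)) (μ : Vec ℕ k) →
  + proj₁ (kostka-unfold k ν α) μ ≡ when (Vec.sum ν ℕ.≟ Vec.sum μ ℕ.+ Vec.last α) (+ kostka k μ (Vec.init α))
kostka-term k ν α μ with Vec.sum ν ℕ.≟ Vec.sum μ ℕ.+ Vec.last α
... | yes _ = refl
... | no _ = refl

sum-toList : ∀ {n} (v : Vec ℕ n) → Vec.sum v ≡ sumℕ (toList v)
sum-toList [] = refl
sum-toList (x ∷ v) = cong (x ℕ.+_) (sum-toList v)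

dropLast-snoc : ∀ (l : List ℕ) y → dropLast (l ++ [ y ]) ≡ l
dropLast-snoc [] y = refl
dropLast-snoc (x ∷ []) y = refl
dropLast-snoc (x ∷ x′ ∷ l) y = cong (x ∷_) (dropLast-snoc (x′ ∷ l) y)

lastOr0-snoc : ∀ (l : List ℕ) y → lastOr0 (l ++ [ y ]) ≡ y
lastOr0-snoc [] y = refl
lastOr0-snoc (x ∷ []) y = refl
lastOr0-snoc (x ∷ x′ ∷ l) y = lastOr0-snoc (x′ ∷ l) y

toList-init : ∀ {n} (α : Vec ℕ (suc n)) → toList (Vec.init α) ≡ dropLast (toList α)
toList-init α with Vec.initLast α
... | ys , y , refl = sym (trans (cong dropLast (VP.toList-∷ʳ y ys)) (dropLast-snoc (toList ys) y))

last-toList : ∀ {n} (α : Vec ℕ (suc n)) → Vec.last α ≡ lastOr0 (toList α)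
last-toList α with Vec.initLast α
... | ys , y , refl = sym (trans (cong lastOr0 (VP.toList-∷ʳ y ys)) (lastOr0-snoc (toList ys) y))

toList-interlacing : ∀ {k} (ν : Vec ℕ (suc k)) → map toList (interlacing ν) ≡ interlacingL (toList ν)
toList-interlacing (a ∷ []) = refl
toList-interlacing (a ∷ b ∷ ν) =
  trans (LP.map-concatMap toList (λ x → map (x ∷_) (interlacing (b ∷ ν))) (range b a))
   (LP.concatMap-cong (λ x → trans (sym (LP.map-∘ (interlacing (b ∷ ν))))
                                   (trans (LP.map-∘ (interlacing (b ∷ ν))) (cong (map (x ∷_)) (toList-interlacing (b ∷ ν)))))
                      (range b a))

∑-sumℕ : ∀ {A : Set} (L : List A) (f : A → ℕ) → + sumℕ (map f L) ≡ ∑[ x ∈ L ] + f x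
∑-sumℕ [] f = refl
∑-sumℕ (x ∷ L) f = trans (ℤP.pos-+ (f x) (sumℕ (map f L))) (cong (_+_ (+ f x)) (∑-sumℕ L f))

kostka-toList : ∀ p (ν α : Vec ℕ p) → + kostka p ν α ≡ kostkaL p (toList ν) (toList α)
kostka-toList zero [] [] = refl
kostka-toList (suc k) ν α =
  trans (∑-sumℕ (interlacing ν) (proj₁ (kostka-unfold k ν α)))
   (trans (∑-cong′ (interlacing ν) (λ μ → trans (kostka-term k ν α μ) (term μ)))
    (trans (sym (∑-map toList (interlacing ν) termL))
     (cong (λ L → ∑ L termL) (toList-interlacing ν))))
  where
  termL : List ℕ → ℤ
  termL μ′ = when (sumℕ (toList ν) ℕ.≟ sumℕ μ′ ℕ.+ lastOr0 (toList α)) (kostkaL k μ′ (dropLast (toList α)))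
  term : ∀ μ → when (Vec.sum ν ℕ.≟ Vec.sum μ ℕ.+ Vec.last α) (+ kostka k μ (Vec.init α)) ≡ termL (toList μ)
  term μ rewrite kostka-toList k μ (Vec.init α) | toList-init α | sum-toList ν | sum-toList μ | last-toList α = refl

_≟ₗ_ : (a b : List ℕ) → Dec (a ≡ b)
_≟ₗ_ = LP.≡-dec ℕ._≟_

Decreasing : List ℕ → Set
Decreasing [] = ⊤
Decreasing (a ∷ []) = ⊤
Decreasing (a ∷ b ∷ l) = b ≤ a × Decreasing (b ∷ l)

Interlaces : List ℕ → List ℕ → Set
Interlaces [] [] = ⊥
Interlaces [] (a ∷ []) = ⊤
Interlaces [] (a ∷ b ∷ ν) = ⊥
Interlaces (x ∷ μ) [] = ⊥
Interlaces (x ∷ μ) (a ∷ []) = ⊥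
Interlaces (x ∷ μ) (a ∷ b ∷ ν) = (b ≤ x × x ≤ a) × Interlaces μ (b ∷ ν)

data _≤ₗ_ : List ℕ → List ℕ → Set where
  [] : [] ≤ₗ []
  _∷_ : ∀ {x a μ ν} → x ≤ a → μ ≤ₗ ν → (x ∷ μ) ≤ₗ (a ∷ ν)

range-sound : ∀ {x} b a → b ≤ a → x ∈ range b a → b ≤ x × x ≤ a
range-sound b a b≤a x∈ with ∈-map⁻ (b ℕ.+_) x∈
... | i , i∈ , refl = ℕP.m≤m+n b i , ℕP.≤-trans (ℕP.+-monoʳ-≤ b (ℕP.≤-pred (∈-upTo⁻ i∈))) (ℕP.≤-reflexive (ℕP.m+[n∸m]≡n b≤a))

interlacingL-sound : ∀ (ν : List ℕ) {μ} → Decreasing ν → μ ∈ interlacingL ν → Interlaces μ ν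
interlacingL-sound (a ∷ []) _ (here refl) = tt
interlacingL-sound (a ∷ b ∷ ν) {μ} (b≤a , dec) μ∈ with find (∈-concatMap⁻ (λ x → map (x ∷_) (interlacingL (b ∷ ν))) {xs = range b a} μ∈)
... | x , x∈ , μ∈′ with ∈-map⁻ (x ∷_) μ∈′
... | μ′ , μ′∈ , refl = range-sound b a b≤a x∈ , interlacingL-sound (b ∷ ν) dec μ′∈

Interlaces-length : ∀ μ ν → Interlaces μ ν → length ν ≡ suc (length μ)
Interlaces-length [] (a ∷ []) _ = refl
Interlaces-length (x ∷ μ) (a ∷ b ∷ ν) (_ , i) = cong suc (Interlaces-length μ (b ∷ ν) i)

Interlaces-decreasing : ∀ μ ν → Interlaces μ ν → Decreasing μ
Interlaces-decreasing [] _ _ = tt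
Interlaces-decreasing (x ∷ []) _ _ = tt
Interlaces-decreasing (x ∷ y ∷ μ) (a ∷ b ∷ c ∷ ν) ((b≤x , _) , (c≤y , y≤b) , i) =
  ℕP.≤-trans y≤b b≤x , Interlaces-decreasing (y ∷ μ) (b ∷ c ∷ ν) ((c≤y , y≤b) , i)

Interlaces-≤ₗ : ∀ μ ν → Interlaces μ ν → μ ≤ₗ dropLast ν
Interlaces-≤ₗ [] (a ∷ []) _ = []
Interlaces-≤ₗ (x ∷ μ) (a ∷ b ∷ ν) ((_ , x≤a) , i) = x≤a ∷ Interlaces-≤ₗ μ (b ∷ ν) i

≤ₗ-sum : ∀ {μ ν} → μ ≤ₗ ν → sumℕ μ ≤ sumℕ ν
≤ₗ-sum [] = z≤n
≤ₗ-sum (x≤a ∷ μ≤ν) = ℕP.+-mono-≤ x≤a (≤ₗ-sum μ≤ν)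

≤ₗ-sum-≡ : ∀ {μ ν} → μ ≤ₗ ν → sumℕ μ ≡ sumℕ ν → μ ≡ ν
≤ₗ-sum-≡ [] _ = refl
≤ₗ-sum-≡ {x ∷ μ} {a ∷ ν} (x≤a ∷ μ≤ν) e with ℕP.m≤n⇒m<n∨m≡n x≤a
... | inj₂ refl = cong (x ∷_) (≤ₗ-sum-≡ μ≤ν (ℕP.+-cancelˡ-≡ x _ _ e))
... | inj₁ x<a = ⊥-elim (ℕP.<⇒≱ (ℕP.+-mono-<-≤ x<a (≤ₗ-sum μ≤ν)) (ℕP.≤-reflexive (sym e)))

sum-dropLast : ∀ (l : List ℕ) → sumℕ l ≡ sumℕ (dropLast l) ℕ.+ lastOr0 l
sum-dropLast [] = refl
sum-dropLast (x ∷ []) = ℕP.+-identityʳ x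
sum-dropLast (x ∷ y ∷ l) = trans (cong (x ℕ.+_) (sum-dropLast (y ∷ l))) (sym (ℕP.+-assoc x _ _))

length-dropLast : ∀ l → length (dropLast l) ≡ length l ∸ 1
length-dropLast [] = refl
length-dropLast (x ∷ []) = refl
length-dropLast (x ∷ y ∷ l) = cong suc (length-dropLast (y ∷ l))

lastOr0-++ : ∀ (β : List ℕ) g γ → lastOr0 (β ++ (g ∷ γ)) ≡ lastOr0 (g ∷ γ)
lastOr0-++ [] g γ = refl
lastOr0-++ (x ∷ []) g γ = refl
lastOr0-++ (x ∷ y ∷ β) g γ = lastOr0-++ (y ∷ β) g γ

dropLast-++ : ∀ (β : List ℕ) g γ → dropLast (β ++ (g ∷ γ)) ≡ β ++ dropLast (g ∷ γ)
dropLast-++ [] g γ = refl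
dropLast-++ (x ∷ []) g γ = refl
dropLast-++ (x ∷ y ∷ β) g γ = cong (x ∷_) (dropLast-++ (y ∷ β) g γ)

when-∷≟ₗ : ∀ x y (μ μ′ : List ℕ) z → when ((x ∷ μ) ≟ₗ (y ∷ μ′)) z ≡ when (x ℕ.≟ y) (when (μ ≟ₗ μ′) z)
when-∷≟ₗ x y μ μ′ z with x ℕ.≟ y | μ ≟ₗ μ′
... | yes _ | yes _ = refl
... | yes _ | no _ = refl
... | no _ | _ = refl

count-range : ∀ x b a (z : ℤ) → b ≤ x → x ≤ a → ∑[ y ∈ range b a ] when (x ℕ.≟ y) z ≡ z
count-range x b a z b≤x x≤a =
  trans (∑-map (b ℕ.+_) (upTo (suc (a ∸ b))) (λ y → when (x ℕ.≟ y) z))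
   (trans (∑-cong′ (upTo (suc (a ∸ b))) (λ i → when-⇔ (x ℕ.≟ b ℕ.+ i) ((x ∸ b) ℕ.≟ i)
             (λ e → trans (cong (_∸ b) e) (ℕP.m+n∸m≡n b i)) (λ e → trans (sym (ℕP.m+[n∸m]≡n b≤x)) (cong (b ℕ.+_) e)) z))
    (trans (count-upTo (x ∸ b) (a ∸ b) z) (when-yes ((x ∸ b) ℕ.≤? (a ∸ b)) (ℕP.∸-monoˡ-≤ b x≤a) z)))

count-interlacingL : ∀ μ ν → Interlaces μ ν → count _≟ₗ_ (interlacingL ν) μ ≡ + 1
count-interlacingL [] (a ∷ []) _ = refl
count-interlacingL (x ∷ μ) (a ∷ b ∷ ν) ((b≤x , x≤a) , i) =
  trans (∑-concatMap (λ y → map (y ∷_) (interlacingL (b ∷ ν))) (range b a) (λ μ′ → 𝟙 ((x ∷ μ) ≟ₗ μ′)))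
   (trans (∑-cong′ (range b a) row) (count-range x b a (+ 1) b≤x x≤a))
  where
  row : ∀ y → ∑[ μ′ ∈ map (y ∷_) (interlacingL (b ∷ ν)) ] 𝟙 ((x ∷ μ) ≟ₗ μ′) ≡ when (x ℕ.≟ y) (+ 1)
  row y = trans (∑-map (y ∷_) (interlacingL (b ∷ ν)) _)
           (trans (∑-cong′ (interlacingL (b ∷ ν)) (λ μ′ → when-∷≟ₗ x y μ μ′ (+ 1)))
            (trans (when-∑ (x ℕ.≟ y) (interlacingL (b ∷ ν)) _) (cong (when (x ℕ.≟ y)) (count-interlacingL μ (b ∷ ν) i))))

∑-interlacingL-++ : ∀ a A b B (g : List ℕ → ℤ) →
  ∑ (interlacingL ((a ∷ A) ++ (b ∷ B))) g
    ≡ ∑[ μA ∈ interlacingL ((a ∷ A) ++ [ b ]) ] ∑[ μB ∈ interlacingL (b ∷ B) ] g (μA ++ μB)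
∑-interlacingL-++ a [] b B g =
  trans (∑-concatMap (λ x → map (x ∷_) (interlacingL (b ∷ B))) (range b a) g)
   (sym (trans (∑-concatMap (λ x → map (x ∷_) (interlacingL (b ∷ []))) (range b a) (λ μA → ∑[ μB ∈ interlacingL (b ∷ B) ] g (μA ++ μB)))
        (∑-cong′ (range b a) (λ x → trans (ℤP.+-identityʳ _) (sym (∑-map (x ∷_) (interlacingL (b ∷ B)) g))))))
∑-interlacingL-++ a (a′ ∷ A) b B g =
  trans (∑-concatMap (λ x → map (x ∷_) (interlacingL (a′ ∷ A ++ b ∷ B))) (range a′ a) g)
   (trans (∑-cong′ (range a′ a) (λ x → trans (∑-map (x ∷_) (interlacingL (a′ ∷ A ++ b ∷ B)) g) (∑-interlacingL-++ a′ A b B (λ μ → g (x ∷ μ)))))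
    (sym (trans (∑-concatMap (λ x → map (x ∷_) (interlacingL (a′ ∷ A ++ [ b ]))) (range a′ a) G)
              (∑-cong′ (range a′ a) (λ x → ∑-map (x ∷_) (interlacingL (a′ ∷ A ++ [ b ])) G)))))
  where
  G : List ℕ → ℤ
  G μA = ∑[ μB ∈ interlacingL (b ∷ B) ] g (μA ++ μB)

Decreasing-split : ∀ A b B → Decreasing (A ++ (b ∷ B)) → Decreasing (A ++ [ b ]) × Decreasing (b ∷ B)
Decreasing-split [] b B d = tt , d
Decreasing-split (a ∷ []) b B (b≤a , d) = (b≤a , tt) , d
Decreasing-split (a ∷ a′ ∷ A) b B (a′≤a , d) with Decreasing-split (a′ ∷ A) b B d
... | d₁ , d₂ = (a′≤a , d₁) , d₂

headOr0 : List ℕ → ℕ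
headOr0 [] = 0
headOr0 (x ∷ _) = x

Decreasing-join : ∀ μA μB → Decreasing μA → Decreasing μB → headOr0 μB ≤ lastOr0 μA → Decreasing (μA ++ μB)
Decreasing-join [] μB _ d _ = d
Decreasing-join (x ∷ []) [] _ _ _ = tt
Decreasing-join (x ∷ []) (y ∷ μB) _ d y≤x = y≤x , d
Decreasing-join (x ∷ x′ ∷ μA) μB (x′≤x , d₁) d₂ le = x′≤x , Decreasing-join (x′ ∷ μA) μB d₁ d₂ le

Interlaces-last : ∀ μ a A b → Interlaces μ ((a ∷ A) ++ [ b ]) → b ≤ lastOr0 μ
Interlaces-last (x ∷ []) a [] b ((b≤x , _) , _) = b≤x
Interlaces-last (x ∷ []) a (a′ ∷ []) b (_ , ())
Interlaces-last (x ∷ []) a (a′ ∷ _ ∷ A) b (_ , ())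
Interlaces-last (x ∷ y ∷ μ) a (a′ ∷ A) b (_ , i) = Interlaces-last (y ∷ μ) a′ A b i

Interlaces-head : ∀ μ b B → Interlaces μ (b ∷ B) → headOr0 μ ≤ b
Interlaces-head [] b B _ = z≤n
Interlaces-head (x ∷ μ) b (c ∷ B) ((_ , x≤b) , _) = x≤b

Interlaces-self : ∀ a A b → Decreasing ((a ∷ A) ++ [ b ]) → Interlaces (a ∷ A) ((a ∷ A) ++ [ b ])
Interlaces-self a [] b (b≤a , _) = (b≤a , ℕP.≤-refl) , tt
Interlaces-self a (a′ ∷ A) b (a′≤a , d) = (a′≤a , ℕP.≤-refl) , Interlaces-self a′ A b d

length-snoc : ∀ (A : List ℕ) b → length (A ++ [ b ]) ≡ suc (length A)
length-snoc A b = trans (LP.length-++ A) (ℕP.+-comm (length A) 1)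

kostkaL-size : ∀ f ν α → length ν ≡ f → length α ≡ f → Decreasing ν → ¬ kostkaL f ν α ≡ + 0 → sumℕ α ≡ sumℕ ν
kostkaL-size zero [] [] _ _ _ _ = refl
kostkaL-size (suc f) ν α lν lα dec nz with ∑-nonzero (interlacingL ν) _ nz
... | μ , μ∈ , term≢0 with when-nonzero (sumℕ ν ℕ.≟ sumℕ μ ℕ.+ lastOr0 α) _ term≢0
... | ν≡μ+last , k≢0 = trans (sum-dropLast α) (trans (cong (ℕ._+ lastOr0 α) μ-size) (sym ν≡μ+last))
  where
  i : Interlaces μ ν
  i = interlacingL-sound ν dec μ∈
  μ-size : sumℕ (dropLast α) ≡ sumℕ μ
  μ-size = kostkaL-size f μ (dropLast α) (ℕP.suc-injective (trans (sym (Interlaces-length μ ν i)) lν))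
                        (trans (length-dropLast α) (cong (_∸ 1) lα)) (Interlaces-decreasing μ ν i) k≢0

record Blocks (n k : ℕ) (A β B γ : List ℕ) : Set where
  field
    length-A : length A ≡ n
    length-β : length β ≡ n
    length-B : length B ≡ k
    length-γ : length γ ≡ k
    decreasing : Decreasing (A ++ B)

kostkaL-++-step : ∀ n k a A b B β g γ →
  kostkaL (n ℕ.+ suc k) ((a ∷ A) ++ (b ∷ B)) (β ++ (g ∷ γ))
    ≡ ∑[ μA ∈ interlacingL ((a ∷ A) ++ [ b ]) ] ∑[ μB ∈ interlacingL (b ∷ B) ]
        when (sumℕ ((a ∷ A) ++ (b ∷ B)) ℕ.≟ sumℕ (μA ++ μB) ℕ.+ lastOr0 (g ∷ γ)) (kostkaL (n ℕ.+ k) (μA ++ μB) (β ++ dropLast (g ∷ γ)))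
kostkaL-++-step n k a A b B β g γ rewrite ℕP.+-suc n k | lastOr0-++ β g γ | dropLast-++ β g γ =
  ∑-interlacingL-++ a A b B _

interlacing-blocks′ : ∀ {n k a A b B β g γ μA μB} → Blocks n (suc k) (a ∷ A) β (b ∷ B) (g ∷ γ) →
  Interlaces μA ((a ∷ A) ++ [ b ]) → Interlaces μB (b ∷ B) →
  Blocks n k μA β μB (dropLast (g ∷ γ)) × μA ≤ₗ (a ∷ A)
interlacing-blocks′ {n} {k} {a} {A} {b} {B} {β} {g} {γ} {μA} {μB} bl iA iB =
  record { length-A = trans (ℕP.suc-injective (trans (sym (Interlaces-length μA _ iA)) (length-snoc (a ∷ A) b))) (length-A bl)
         ; length-β = length-β bl
         ; length-B = ℕP.suc-injective (trans (sym (Interlaces-length μB (b ∷ B) iB)) (length-B bl))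
         ; length-γ = trans (length-dropLast (g ∷ γ)) (cong (_∸ 1) (length-γ bl))
         ; decreasing = Decreasing-join μA μB (Interlaces-decreasing μA _ iA) (Interlaces-decreasing μB (b ∷ B) iB)
                          (ℕP.≤-trans (Interlaces-head μB b B iB) (Interlaces-last μA a A b iA)) } ,
  subst (μA ≤ₗ_) (dropLast-snoc (a ∷ A) b) (Interlaces-≤ₗ μA _ iA)
  where open Blocks

interlacing-blocks : ∀ {n k a A b B β g γ μA μB} → Blocks n (suc k) (a ∷ A) β (b ∷ B) (g ∷ γ) →
  μA ∈ interlacingL ((a ∷ A) ++ [ b ]) → μB ∈ interlacingL (b ∷ B) →
  Blocks n k μA β μB (dropLast (g ∷ γ)) × μA ≤ₗ (a ∷ A)
interlacing-blocks {a = a} {A} {b} {B} bl μA∈ μB∈ =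
  interlacing-blocks′ bl (interlacingL-sound _ (proj₁ dec) μA∈) (interlacingL-sound (b ∷ B) (proj₂ dec) μB∈)
  where
  dec : Decreasing ((a ∷ A) ++ [ b ]) × Decreasing (b ∷ B)
  dec = Decreasing-split (a ∷ A) b B (Blocks.decreasing bl)

-- If K_{A++B}(β++γ) ≠ 0 then |β| ≤ |A|: the entries 1…n fill at most the first block.
kostkaL-++-bound : ∀ n k A β B γ → Blocks n k A β B γ →
  ¬ kostkaL (n ℕ.+ k) (A ++ B) (β ++ γ) ≡ + 0 → sumℕ β ≤ sumℕ A
kostkaL-++-bound n k [] [] B γ bl nz = z≤n
kostkaL-++-bound n k [] (x ∷ β) B γ bl nz = ⊥-elim (ℕP.0≢1+n (trans (Blocks.length-A bl) (sym (Blocks.length-β bl))))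
kostkaL-++-bound n zero (a ∷ A) β [] [] bl nz rewrite LP.++-identityʳ (a ∷ A) | LP.++-identityʳ β | ℕP.+-identityʳ n =
  ℕP.≤-reflexive (kostkaL-size n (a ∷ A) β (length-A bl) (length-β bl) (subst Decreasing (LP.++-identityʳ (a ∷ A)) (decreasing bl)) nz)
  where open Blocks
kostkaL-++-bound n (suc k) (a ∷ A) β (b ∷ B) (g ∷ γ) bl nz
  with ∑-nonzero (interlacingL ((a ∷ A) ++ [ b ])) _ (λ e → nz (trans (kostkaL-++-step n k a A b B β g γ) e))
... | μA , μA∈ , nz′ with ∑-nonzero (interlacingL (b ∷ B)) _ nz′
... | μB , μB∈ , nz″ =
  let (bl′ , μA≤A) = interlacing-blocks bl μA∈ μB∈ in
  ℕP.≤-trans (kostkaL-++-bound n k μA β μB (dropLast (g ∷ γ)) bl′ (proj₂ (when-nonzero _ _ nz″))) (≤ₗ-sum μA≤A)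
kostkaL-++-bound n zero (a ∷ A) β [] (_ ∷ _) bl nz with Blocks.length-γ bl
... | ()
kostkaL-++-bound n zero (a ∷ A) β (_ ∷ _) γ bl nz with Blocks.length-B bl
... | ()
kostkaL-++-bound n (suc k) (a ∷ A) β [] γ bl nz with Blocks.length-B bl
... | ()
kostkaL-++-bound n (suc k) (a ∷ A) β (b ∷ B) [] bl nz with Blocks.length-γ bl
... | ()

++-size-cancel : ∀ A X Y l → sumℕ (A ++ X) ≡ sumℕ (A ++ Y) ℕ.+ l → sumℕ X ≡ sumℕ Y ℕ.+ l
++-size-cancel A X Y l e =
  ℕP.+-cancelˡ-≡ (sumℕ A) _ _ (trans (sym (ℕListP.sum-++ A X)) (trans e (trans (cong (ℕ._+ l) (ℕListP.sum-++ A Y)) (ℕP.+-assoc (sumℕ A) _ _))))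

++-size-extend : ∀ A X Y l → sumℕ X ≡ sumℕ Y ℕ.+ l → sumℕ (A ++ X) ≡ sumℕ (A ++ Y) ℕ.+ l
++-size-extend A X Y l e =
  trans (ℕListP.sum-++ A X) (trans (cong (sumℕ A ℕ.+_) e) (trans (sym (ℕP.+-assoc (sumℕ A) _ _)) (cong (ℕ._+ l) (sym (ℕListP.sum-++ A Y)))))

-- When |β| = |A|, a non-zero term in the recursion for K_{A++B}(β++γ) keeps the
-- first block A: the entries 1…n must fill it.
kostkaL-++-first-block : ∀ {n k a A b B β g γ μA μB} → Blocks n (suc k) (a ∷ A) β (b ∷ B) (g ∷ γ) → sumℕ β ≡ sumℕ (a ∷ A) →
  μA ∈ interlacingL ((a ∷ A) ++ [ b ]) → μB ∈ interlacingL (b ∷ B) →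
  ¬ kostkaL (n ℕ.+ k) (μA ++ μB) (β ++ dropLast (g ∷ γ)) ≡ + 0 → μA ≡ a ∷ A
kostkaL-++-first-block {n} {k} {β = β} {g = g} {γ} {μA} {μB} bl β≡A μA∈ μB∈ nz =
  let (bl′ , μA≤A) = interlacing-blocks bl μA∈ μB∈
      β≤μA = kostkaL-++-bound n k μA β μB (dropLast (g ∷ γ)) bl′ nz
  in ≤ₗ-sum-≡ μA≤A (ℕP.≤-antisym (≤ₗ-sum μA≤A) (subst (_≤ sumℕ μA) β≡A β≤μA))

kostkaL-++-factor : ∀ n k A β B γ → Blocks n k A β B γ → sumℕ β ≡ sumℕ A →
  kostkaL (n ℕ.+ k) (A ++ B) (β ++ γ) ≡ kostkaL n A β * kostkaL k B γ
kostkaL-++-factor n k [] [] B γ bl _ rewrite sym (Blocks.length-A bl) = sym (ℤP.*-identityˡ _)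
kostkaL-++-factor n k [] (x ∷ β) B γ bl _ = ⊥-elim (ℕP.0≢1+n (trans (Blocks.length-A bl) (sym (Blocks.length-β bl))))
kostkaL-++-factor n zero (a ∷ A) β [] [] bl _ rewrite LP.++-identityʳ (a ∷ A) | LP.++-identityʳ β | ℕP.+-identityʳ n =
  sym (ℤP.*-identityʳ _)
kostkaL-++-factor n zero (a ∷ A) β [] (_ ∷ _) bl _ with Blocks.length-γ bl
... | ()
kostkaL-++-factor n zero (a ∷ A) β (_ ∷ _) γ bl _ with Blocks.length-B bl
... | ()
kostkaL-++-factor n (suc k) (a ∷ A) β [] γ bl _ with Blocks.length-B bl
... | ()
kostkaL-++-factor n (suc k) (a ∷ A) β (b ∷ B) [] bl _ with Blocks.length-γ bl
... | ()
kostkaL-++-factor n (suc k) (a ∷ A) β (b ∷ B) (g ∷ γ) bl β≡A =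
  trans (kostkaL-++-step n k a A b B β g γ)
   (trans (∑-single _≟ₗ_ (interlacingL (AA ++ [ b ])) AA inner other-blocks-vanish)
    (trans (cong (_* inner AA) (count-interlacingL AA (AA ++ [ b ]) (Interlaces-self a A b decA)))
     (trans (ℤP.*-identityˡ (inner AA))
      (trans (∑-cong (interlacingL (b ∷ B)) first-block-A)
       (∑-*ˡ (interlacingL (b ∷ B)) (kostkaL n AA β) _)))))
  where
  AA BB GG : List ℕ
  AA = a ∷ A
  BB = b ∷ B
  GG = g ∷ γ
  decA : Decreasing (AA ++ [ b ])
  decA = proj₁ (Decreasing-split AA b B (Blocks.decreasing bl))
  decB : Decreasing BB
  decB = proj₂ (Decreasing-split AA b B (Blocks.decreasing bl))
  term : List ℕ → List ℕ → ℤ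
  term μA μB = when (sumℕ (AA ++ BB) ℕ.≟ sumℕ (μA ++ μB) ℕ.+ lastOr0 GG) (kostkaL (n ℕ.+ k) (μA ++ μB) (β ++ dropLast GG))
  inner : List ℕ → ℤ
  inner μA = ∑[ μB ∈ interlacingL BB ] term μA μB
  other-blocks-vanish : ∀ {μA} → μA ∈ interlacingL (AA ++ [ b ]) → ¬ μA ≡ AA → inner μA ≡ + 0
  other-blocks-vanish {μA} μA∈ μA≢A = ∑-zero (interlacingL BB) vanish
    where
    vanish : ∀ {μB} → μB ∈ interlacingL BB → term μA μB ≡ + 0
    vanish {μB} μB∈ with term μA μB ℤ.≟ + 0
    ... | yes z = z
    ... | no nz = ⊥-elim (μA≢A (kostkaL-++-first-block bl β≡A μA∈ μB∈ (proj₂ (when-nonzero _ _ nz))))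
  first-block-A : ∀ {μB} → μB ∈ interlacingL BB →
    term AA μB ≡ kostkaL n AA β * when (sumℕ BB ℕ.≟ sumℕ μB ℕ.+ lastOr0 GG) (kostkaL k μB (dropLast GG))
  first-block-A {μB} μB∈ =
    trans (when-⇔ _ (sumℕ BB ℕ.≟ sumℕ μB ℕ.+ lastOr0 GG) (++-size-cancel AA BB μB (lastOr0 GG)) (++-size-extend AA BB μB (lastOr0 GG)) _)
     (trans (when-cong (sumℕ BB ℕ.≟ sumℕ μB ℕ.+ lastOr0 GG)
              (λ _ → kostkaL-++-factor n k AA β μB (dropLast GG) (proj₁ (interlacing-blocks′ bl (Interlaces-self a A b decA) (interlacingL-sound BB decB μB∈))) β≡A))
      (sym (when-*ˡ (sumℕ BB ℕ.≟ sumℕ μB ℕ.+ lastOr0 GG) (kostkaL n AA β) _)))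

-- Adding c to every part of the shape: K_{μ+c}(β) = [β ≥ c] K_μ(β - c),
-- as the first c columns of a tableau of shape μ + c are forced.

addEach subEach : ℕ → List ℕ → List ℕ
addEach c = map (ℕ._+ c)
subEach c = map (_∸ c)

AllAtLeast : ℕ → List ℕ → Set
AllAtLeast c = All (c ≤_)

allAtLeast? : ∀ c β → Dec (AllAtLeast c β)
allAtLeast? c = all? (c ℕ.≤?_)

∑-range-+ : ∀ b a c (g : ℕ → ℤ) → ∑ (range (b ℕ.+ c) (a ℕ.+ c)) g ≡ ∑[ x ∈ range b a ] g (x ℕ.+ c)
∑-range-+ b a c g =
  trans (∑-map ((b ℕ.+ c) ℕ.+_) (upTo (suc ((a ℕ.+ c) ∸ (b ℕ.+ c)))) g)
   (trans (cong (λ n → ∑[ i ∈ upTo (suc n) ] g (b ℕ.+ c ℕ.+ i)) (trans (cong₂ _∸_ (ℕP.+-comm a c) (ℕP.+-comm b c)) (ℕP.[m+n]∸[m+o]≡n∸o c a b)))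
    (trans (∑-cong′ (upTo (suc (a ∸ b))) (λ i → cong g (trans (ℕP.+-assoc b c i) (trans (cong (b ℕ.+_) (ℕP.+-comm c i)) (sym (ℕP.+-assoc b i c))))))
     (sym (∑-map (b ℕ.+_) (upTo (suc (a ∸ b))) (λ x → g (x ℕ.+ c))))))

∑-interlacingL-+ : ∀ c μ (g : List ℕ → ℤ) → ∑ (interlacingL (addEach c μ)) g ≡ ∑[ ρ ∈ interlacingL μ ] g (addEach c ρ)
∑-interlacingL-+ c [] g = refl
∑-interlacingL-+ c (a ∷ []) g = refl
∑-interlacingL-+ c (a ∷ b ∷ ν) g =
  trans (∑-concatMap (λ x → map (x ∷_) (interlacingL (addEach c (b ∷ ν)))) (range (b ℕ.+ c) (a ℕ.+ c)) g)
   (trans (∑-range-+ b a c (λ x → ∑ (map (x ∷_) (interlacingL (addEach c (b ∷ ν)))) g))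
    (trans (∑-cong′ (range b a) (λ x → trans (∑-map (x ℕ.+ c ∷_) (interlacingL (addEach c (b ∷ ν))) g)
              (trans (∑-interlacingL-+ c (b ∷ ν) (λ ρ → g (x ℕ.+ c ∷ ρ))) (sym (∑-map (x ∷_) (interlacingL (b ∷ ν)) (λ ρ → g (addEach c ρ)))))))
     (sym (∑-concatMap (λ x → map (x ∷_) (interlacingL (b ∷ ν))) (range b a) (λ ρ → g (addEach c ρ))))))

sum-addEach : ∀ c μ → sumℕ (addEach c μ) ≡ sumℕ μ ℕ.+ length μ ℕ.* c
sum-addEach c [] = refl
sum-addEach c (a ∷ μ) = trans (cong (a ℕ.+ c ℕ.+_) (sum-addEach c μ)) (rearrange a c (sumℕ μ) (length μ ℕ.* c))
  where
  rearrange : ∀ a c s t → a ℕ.+ c ℕ.+ (s ℕ.+ t) ≡ a ℕ.+ s ℕ.+ (c ℕ.+ t)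
  rearrange = ℕSolver.solve-∀

dropLast-map : ∀ (g : ℕ → ℕ) β → dropLast (map g β) ≡ map g (dropLast β)
dropLast-map g [] = refl
dropLast-map g (x ∷ []) = refl
dropLast-map g (x ∷ y ∷ β) = cong (g x ∷_) (dropLast-map g (y ∷ β))

lastOr0-map : ∀ (g : ℕ → ℕ) x β → lastOr0 (map g (x ∷ β)) ≡ g (lastOr0 (x ∷ β))
lastOr0-map g x [] = refl
lastOr0-map g x (y ∷ β) = lastOr0-map g y β

AllAtLeast-dropLast⁻ : ∀ c x β → AllAtLeast c (x ∷ β) → AllAtLeast c (dropLast (x ∷ β)) × c ≤ lastOr0 (x ∷ β)
AllAtLeast-dropLast⁻ c x [] (c≤x ∷ []) = [] , c≤x
AllAtLeast-dropLast⁻ c x (y ∷ β) (c≤x ∷ rest) = let (r₁ , r₂) = AllAtLeast-dropLast⁻ c y β rest in (c≤x ∷ r₁) , r₂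

AllAtLeast-dropLast⁺ : ∀ c x β → AllAtLeast c (dropLast (x ∷ β)) → c ≤ lastOr0 (x ∷ β) → AllAtLeast c (x ∷ β)
AllAtLeast-dropLast⁺ c x [] [] c≤x = c≤x ∷ []
AllAtLeast-dropLast⁺ c x (y ∷ β) (c≤x ∷ rest) c≤l = c≤x ∷ AllAtLeast-dropLast⁺ c y β rest c≤l

balance⇒ : ∀ s r l c → r ≤ s → s ℕ.+ c ≡ r ℕ.+ l → c ≤ l × s ≡ r ℕ.+ (l ∸ c)
balance⇒ s r l c r≤s e = c≤l , ℕP.+-cancelʳ-≡ c _ _ (trans e (trans (cong (r ℕ.+_) (sym (ℕP.m∸n+n≡m c≤l))) (sym (ℕP.+-assoc r (l ∸ c) c))))
  where
  c≤l : c ≤ l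
  c≤l = ℕP.+-cancelˡ-≤ r c l (subst (_≤ r ℕ.+ l) (ℕP.+-comm c r) (subst (c ℕ.+ r ≤_) e (subst (_≤ s ℕ.+ c) (ℕP.+-comm r c) (ℕP.+-monoˡ-≤ c r≤s))))

balance⇐ : ∀ s r l c → c ≤ l → s ≡ r ℕ.+ (l ∸ c) → s ℕ.+ c ≡ r ℕ.+ l
balance⇐ s r l c c≤l e = trans (cong (ℕ._+ c) e) (trans (ℕP.+-assoc r (l ∸ c) c) (cong (r ℕ.+_) (ℕP.m∸n+n≡m c≤l)))

addEach-size-difference : ∀ f c μ ρ l → length μ ≡ suc f → length ρ ≡ f →
  (sumℕ (addEach c μ) ≡ sumℕ (addEach c ρ) ℕ.+ l → sumℕ μ ℕ.+ c ≡ sumℕ ρ ℕ.+ l) ×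
  (sumℕ μ ℕ.+ c ≡ sumℕ ρ ℕ.+ l → sumℕ (addEach c μ) ≡ sumℕ (addEach c ρ) ℕ.+ l)
addEach-size-difference f c μ ρ l lμ lρ =
  (λ e → ℕP.+-cancelʳ-≡ F _ _ (trans (sym size-μ) (trans e size-ρ))) ,
  (λ e → trans size-μ (trans (cong (ℕ._+ F) e) (sym size-ρ)))
  where
  F : ℕ
  F = f ℕ.* c
  size-μ : sumℕ (addEach c μ) ≡ sumℕ μ ℕ.+ c ℕ.+ F
  size-μ = trans (sum-addEach c μ) (trans (cong (λ n → sumℕ μ ℕ.+ n ℕ.* c) lμ) (sym (ℕP.+-assoc (sumℕ μ) c F)))
  size-ρ : sumℕ (addEach c ρ) ℕ.+ l ≡ sumℕ ρ ℕ.+ l ℕ.+ F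
  size-ρ = trans (cong (ℕ._+ l) (trans (sum-addEach c ρ) (cong (λ n → sumℕ ρ ℕ.+ n ℕ.* c) lρ))) (rearrange (sumℕ ρ) F l)
    where
    rearrange : ∀ r F l → r ℕ.+ F ℕ.+ l ≡ r ℕ.+ l ℕ.+ F
    rearrange = ℕSolver.solve-∀

kostkaL-addEach : ∀ f μ β c → length μ ≡ f → length β ≡ f → Decreasing μ →
  kostkaL f (addEach c μ) β ≡ when (allAtLeast? c β) (kostkaL f μ (subEach c β))
kostkaL-addEach zero [] [] c _ _ _ = refl
kostkaL-addEach (suc f) μ (x ∷ β) c lμ lβ dec =
  trans (∑-interlacingL-+ c μ _)
   (trans (∑-cong (interlacingL μ) (λ ρ∈ → step _ (interlacingL-sound μ dec ρ∈)))
    (when-∑ (allAtLeast? c (x ∷ β)) (interlacingL μ) _))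
  where
  l : ℕ
  l = lastOr0 (x ∷ β)
  step : ∀ ρ → Interlaces ρ μ →
    when (sumℕ (addEach c μ) ℕ.≟ sumℕ (addEach c ρ) ℕ.+ l) (kostkaL f (addEach c ρ) (dropLast (x ∷ β)))
      ≡ when (allAtLeast? c (x ∷ β)) (when (sumℕ μ ℕ.≟ sumℕ ρ ℕ.+ lastOr0 (subEach c (x ∷ β))) (kostkaL f ρ (dropLast (subEach c (x ∷ β)))))
  step ρ i
    rewrite lastOr0-map (_∸ c) x β | dropLast-map (_∸ c) (x ∷ β)
          | kostkaL-addEach f ρ (dropLast (x ∷ β)) c (ℕP.suc-injective (trans (sym (Interlaces-length ρ μ i)) lμ))
                            (trans (length-dropLast (x ∷ β)) (cong (_∸ 1) lβ)) (Interlaces-decreasing ρ μ i) =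
    trans (when-× (sumℕ (addEach c μ) ℕ.≟ sumℕ (addEach c ρ) ℕ.+ l) (allAtLeast? c (dropLast (x ∷ β))) _)
     (trans (when-⇔ _ ((allAtLeast? c (x ∷ β)) ×-dec (sumℕ μ ℕ.≟ sumℕ ρ ℕ.+ (l ∸ c))) forward backward _)
      (sym (when-× (allAtLeast? c (x ∷ β)) (sumℕ μ ℕ.≟ sumℕ ρ ℕ.+ (l ∸ c)) _)))
    where
    ρ≤μ : sumℕ ρ ≤ sumℕ μ
    ρ≤μ = ℕP.≤-trans (≤ₗ-sum (Interlaces-≤ₗ ρ μ i)) (subst (sumℕ (dropLast μ) ≤_) (sym (sum-dropLast μ)) (ℕP.m≤m+n _ _))
    sizes : (sumℕ (addEach c μ) ≡ sumℕ (addEach c ρ) ℕ.+ l → sumℕ μ ℕ.+ c ≡ sumℕ ρ ℕ.+ l) ×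
            (sumℕ μ ℕ.+ c ≡ sumℕ ρ ℕ.+ l → sumℕ (addEach c μ) ≡ sumℕ (addEach c ρ) ℕ.+ l)
    sizes = addEach-size-difference f c μ ρ l lμ (ℕP.suc-injective (trans (sym (Interlaces-length ρ μ i)) lμ))
    forward : sumℕ (addEach c μ) ≡ sumℕ (addEach c ρ) ℕ.+ l × AllAtLeast c (dropLast (x ∷ β)) →
              AllAtLeast c (x ∷ β) × sumℕ μ ≡ sumℕ ρ ℕ.+ (l ∸ c)
    forward (e , all) =
      let (c≤l , e′) = balance⇒ (sumℕ μ) (sumℕ ρ) l c ρ≤μ (proj₁ sizes e) in AllAtLeast-dropLast⁺ c x β all c≤l , e′
    backward : AllAtLeast c (x ∷ β) × sumℕ μ ≡ sumℕ ρ ℕ.+ (l ∸ c) →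
               sumℕ (addEach c μ) ≡ sumℕ (addEach c ρ) ℕ.+ l × AllAtLeast c (dropLast (x ∷ β))
    backward (all , e) =
      let (all′ , c≤l) = AllAtLeast-dropLast⁻ c x β all in proj₂ sizes (balance⇐ (sumℕ μ) (sumℕ ρ) l c c≤l e) , all′

DecreasingV : ∀ {p} → Vec ℕ p → Set
DecreasingV ν = Decreasing (toList ν)

blocks-toList : ∀ {m k} (A β : Vec ℕ m) (B γ : Vec ℕ k) → DecreasingV (A Vec.++ B) → Blocks m k (toList A) (toList β) (toList B) (toList γ)
blocks-toList A β B γ dec = record
  { length-A = VP.length-toList A ; length-β = VP.length-toList β
  ; length-B = VP.length-toList B ; length-γ = VP.length-toList γ
  ; decreasing = subst Decreasing (VP.toList-++ A B) dec }

schurCoeff-++-toList : ∀ {m k} (A β : Vec ℕ m) (B γ : Vec ℕ k) →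
  schurCoeff (A Vec.++ B) (β Vec.++ γ) ≡ kostkaL (m ℕ.+ k) (toList A ++ toList B) (toList β ++ toList γ)
schurCoeff-++-toList {m} {k} A β B γ =
  trans (kostka-toList (m ℕ.+ k) (A Vec.++ B) (β Vec.++ γ)) (cong₂ (kostkaL (m ℕ.+ k)) (VP.toList-++ A B) (VP.toList-++ β γ))

schurCoeff-++-bound : ∀ {m k} (A β : Vec ℕ m) (B γ : Vec ℕ k) → DecreasingV (A Vec.++ B) →
  ¬ schurCoeff (A Vec.++ B) (β Vec.++ γ) ≡ + 0 → Vec.sum β ≤ Vec.sum A
schurCoeff-++-bound {m} {k} A β B γ dec nz =
  subst₂ _≤_ (sym (sum-toList β)) (sym (sum-toList A))
    (kostkaL-++-bound m k (toList A) (toList β) (toList B) (toList γ) (blocks-toList A β B γ dec) (nz ∘ trans (schurCoeff-++-toList A β B γ)))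

schurCoeff-++-factor : ∀ {m k} (A β : Vec ℕ m) (B γ : Vec ℕ k) → DecreasingV (A Vec.++ B) →
  Vec.sum β ≡ Vec.sum A → schurCoeff (A Vec.++ B) (β Vec.++ γ) ≡ schurCoeff A β * schurCoeff B γ
schurCoeff-++-factor {m} {k} A β B γ dec e =
  trans (schurCoeff-++-toList A β B γ)
   (trans (kostkaL-++-factor m k (toList A) (toList β) (toList B) (toList γ) (blocks-toList A β B γ dec)
            (trans (sym (sum-toList β)) (trans e (sum-toList A))))
    (sym (cong₂ _*_ (kostka-toList m A β) (kostka-toList k B γ))))

toList-+ᵥ : ∀ {m} c (μ : Vec ℕ m) → toList (μ +ᵥ replicate m c) ≡ addEach c (toList μ)
toList-+ᵥ c [] = refl
toList-+ᵥ c (x ∷ μ) = cong (x ℕ.+ c ∷_) (toList-+ᵥ c μ)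

toList-∸ᵥ : ∀ {m} c (β : Vec ℕ m) → toList (β ∸ᵥ replicate m c) ≡ subEach c (toList β)
toList-∸ᵥ c [] = refl
toList-∸ᵥ c (x ∷ β) = cong (x ∸ c ∷_) (toList-∸ᵥ c β)

≤ᵥ⇔AllAtLeast : ∀ {m} c (β : Vec ℕ m) → (replicate m c ≤ᵥ β → AllAtLeast c (toList β)) × (AllAtLeast c (toList β) → replicate m c ≤ᵥ β)
≤ᵥ⇔AllAtLeast c [] = (λ _ → []) , (λ _ → [])
≤ᵥ⇔AllAtLeast c (x ∷ β) =
  (λ { (c≤x ∷ rest) → c≤x ∷ proj₁ (≤ᵥ⇔AllAtLeast c β) rest }) ,
  (λ { (c≤x ∷ rest) → c≤x ∷ proj₂ (≤ᵥ⇔AllAtLeast c β) rest })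

schurCoeff-+ᵥ : ∀ m c (μ β : Vec ℕ m) → DecreasingV μ →
  schurCoeff (μ +ᵥ replicate m c) β ≡ raise c (schurCoeff μ) β
schurCoeff-+ᵥ m c μ β dec =
  trans (kostka-toList m (μ +ᵥ replicate m c) β)
   (trans (cong (λ l → kostkaL m l (toList β)) (toList-+ᵥ c μ))
    (trans (kostkaL-addEach m (toList μ) (toList β) c (VP.length-toList μ) (VP.length-toList β) dec)
     (trans (when-⇔ (allAtLeast? c (toList β)) (replicate m c ≤ᵥ? β) (proj₂ (≤ᵥ⇔AllAtLeast c β)) (proj₁ (≤ᵥ⇔AllAtLeast c β)) _)
      (cong (when (replicate m c ≤ᵥ? β))
       (sym (trans (kostka-toList m μ (β ∸ᵥ replicate m c)) (cong (kostkaL m (toList μ)) (toList-∸ᵥ c β))))))))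

headAtMost : ∀ {p} → ℕ → Vec ℕ p → Set
headAtMost b [] = ⊤
headAtMost b (x ∷ _) = x ≤ b

DecreasingV-∷ : ∀ {p} x (ν : Vec ℕ p) → DecreasingV (x ∷ ν) → headAtMost x ν × DecreasingV ν
DecreasingV-∷ x [] _ = tt , tt
DecreasingV-∷ x (y ∷ ν) (y≤x , dec) = y≤x , dec

DecreasingV-∷⁺ : ∀ {p} x (ν : Vec ℕ p) → headAtMost x ν → DecreasingV ν → DecreasingV (x ∷ ν)
DecreasingV-∷⁺ x [] _ _ = tt
DecreasingV-∷⁺ x (y ∷ ν) y≤x dec = y≤x , dec

partitionsB-sound : ∀ p b d (ν : Vec ℕ p) → ν ∈ partitionsB p b d → DecreasingV ν × headAtMost b ν × Vec.sum ν ≡ d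
partitionsB-sound zero b zero [] _ = tt , tt , refl
partitionsB-sound (suc p) b d ν ν∈
  with find (∈-concatMap⁻ (λ a → map (a ∷_) (partitionsB p a (d ∸ a))) {xs = filter (ℕ._≤? d) (upTo (suc b))} ν∈)
... | a , a∈ , ν∈′ with ∈-map⁻ (a ∷_) ν∈′
... | ν′ , ν′∈ , refl with ∈-filter⁻ (ℕ._≤? d) {xs = upTo (suc b)} a∈ | partitionsB-sound p a (d ∸ a) ν′ ν′∈
... | a∈′ , a≤d | dec , head , e =
  DecreasingV-∷⁺ a ν′ head dec , ℕP.≤-pred (∈-upTo⁻ a∈′) , trans (cong (a ℕ.+_) e) (ℕP.m+[n∸m]≡n a≤d)

∑-filter : {A : Set} {P : Pred A _} (P? : Decidable P) (L : List A) (g : A → ℤ) →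
  ∑ (filter P? L) g ≡ ∑[ x ∈ L ] when (P? x) (g x)
∑-filter P? [] g = refl
∑-filter P? (x ∷ L) g with P? x
... | yes _ = cong (_+_ (g x)) (∑-filter P? L g)
... | no _ = trans (∑-filter P? L g) (sym (ℤP.+-identityˡ _))

partitionsB-count : ∀ p b d (α : Vec ℕ p) → DecreasingV α → headAtMost b α → Vec.sum α ≡ d →
  count _≟ᵥ_ (partitionsB p b d) α ≡ + 1
partitionsB-count zero b zero [] _ _ _ = refl
partitionsB-count (suc p) b d (x ∷ α) dec x≤b e =
  trans (∑-concatMap (λ a → map (a ∷_) (partitionsB p a (d ∸ a))) (filter (ℕ._≤? d) (upTo (suc b))) _)
   (trans (∑-filter (ℕ._≤? d) (upTo (suc b)) (λ a → ∑[ ν ∈ map (a ∷_) (partitionsB p a (d ∸ a)) ] 𝟙 ((x ∷ α) ≟ᵥ ν)))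
    (trans (∑-cong′ (upTo (suc b)) row)
     (trans (count-upTo x b (+ 1)) (when-yes (x ℕ.≤? b) x≤b (+ 1)))))
  where
  x≤d : x ≤ d
  x≤d = subst (x ≤_) e (ℕP.m≤m+n x (Vec.sum α))
  rest : headAtMost x α × DecreasingV α
  rest = DecreasingV-∷ x α dec
  row : ∀ a → when (a ℕ.≤? d) (∑[ ν ∈ map (a ∷_) (partitionsB p a (d ∸ a)) ] 𝟙 ((x ∷ α) ≟ᵥ ν)) ≡ when (x ℕ.≟ a) (+ 1)
  row a =
    trans (cong (when (a ℕ.≤? d)) (trans (∑-map (a ∷_) (partitionsB p a (d ∸ a)) _)
                                   (trans (∑-cong′ (partitionsB p a (d ∸ a)) (λ ν → when-∷≟ x a α ν (+ 1)))
                                          (when-∑ (x ℕ.≟ a) (partitionsB p a (d ∸ a)) _))))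
     (first-entry (x ℕ.≟ a))
    where
    first-entry : (x≟a : Dec (x ≡ a)) → when (a ℕ.≤? d) (when x≟a (count _≟ᵥ_ (partitionsB p a (d ∸ a)) α)) ≡ when x≟a (+ 1)
    first-entry (no _) = when-0 (a ℕ.≤? d)
    first-entry (yes refl) =
      trans (when-yes (x ℕ.≤? d) x≤d _)
       (partitionsB-count p x (d ∸ x) α (proj₂ rest) (proj₁ rest) (trans (sym (ℕP.m+n∸m≡n x (Vec.sum α))) (cong (_∸ x) e)))

headAtMost-sum : ∀ {p} (ν : Vec ℕ p) → headAtMost (Vec.sum ν) ν
headAtMost-sum [] = tt
headAtMost-sum (x ∷ ν) = ℕP.m≤m+n x _

partitions-sound : ∀ p d (ν : Vec ℕ p) → ν ∈ partitions p d → DecreasingV ν × Vec.sum ν ≡ d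
partitions-sound p d ν ν∈ = let (dec , _ , e) = partitionsB-sound p d d ν ν∈ in dec , e

partitions-count : ∀ p d (α : Vec ℕ p) → DecreasingV α → Vec.sum α ≡ d → count _≟ᵥ_ (partitions p d) α ≡ + 1
partitions-count p d α dec e = partitionsB-count p d d α dec (subst (λ s → headAtMost s α) e (headAtMost-sum α)) e

decreasingL? : (l : List ℕ) → Dec (Decreasing l)
decreasingL? [] = yes tt
decreasingL? (a ∷ []) = yes tt
decreasingL? (a ∷ b ∷ l) = (b ℕ.≤? a) ×-dec decreasingL? (b ∷ l)

decreasing? : ∀ {p} (ν : Vec ℕ p) → Dec (DecreasingV ν)
decreasing? ν = decreasingL? (toList ν)

Decreasing-++⁻ : ∀ (l₁ l₂ : List ℕ) → Decreasing (l₁ ++ l₂) → Decreasing l₁ × Decreasing l₂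
Decreasing-++⁻ [] l₂ d = tt , d
Decreasing-++⁻ (a ∷ []) [] d = tt , tt
Decreasing-++⁻ (a ∷ []) (b ∷ l₂) (_ , d) = tt , d
Decreasing-++⁻ (a ∷ a′ ∷ l₁) l₂ (a′≤a , d) = let (d₁ , d₂) = Decreasing-++⁻ (a′ ∷ l₁) l₂ d in (a′≤a , d₁) , d₂

DecreasingV-++⁻ : ∀ {m k} (A : Vec ℕ m) (B : Vec ℕ k) → DecreasingV (A Vec.++ B) → DecreasingV A × DecreasingV B
DecreasingV-++⁻ A B d = Decreasing-++⁻ (toList A) (toList B) (subst Decreasing (VP.toList-++ A B) d)

take-drop-++ : ∀ {m k} (A : Vec ℕ m) (B : Vec ℕ k) → Vec.take m (A Vec.++ B) ≡ A × Vec.drop m (A Vec.++ B) ≡ B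
take-drop-++ {m} A B = VP.++-injective (Vec.take m (A Vec.++ B)) A (VP.take++drop≡id m (A Vec.++ B))

DecreasingV-blocks : ∀ m {k} (ν : Vec ℕ (m ℕ.+ k)) → DecreasingV ν → DecreasingV (Vec.take m ν) × DecreasingV (Vec.drop m ν)
DecreasingV-blocks m ν d = DecreasingV-++⁻ (Vec.take m ν) (Vec.drop m ν) (subst DecreasingV (sym (VP.take++drop≡id m ν)) d)

sum-blocks : ∀ m {k} (ν : Vec ℕ (m ℕ.+ k)) → Vec.sum ν ≡ Vec.sum (Vec.take m ν) ℕ.+ Vec.sum (Vec.drop m ν)
sum-blocks m ν = trans (cong Vec.sum (sym (VP.take++drop≡id m ν))) (VP.sum-++ (Vec.take m ν))

𝟙-++ : ∀ {m k} (A C : Vec ℕ m) (B D : Vec ℕ k) → 𝟙 ((A Vec.++ B) ≟ᵥ (C Vec.++ D)) ≡ when (A ≟ᵥ C) (𝟙 (B ≟ᵥ D))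
𝟙-++ A C B D with A ≟ᵥ C | B ≟ᵥ D
... | yes refl | yes refl = when-yes ((A Vec.++ B) ≟ᵥ (A Vec.++ B)) refl (+ 1)
... | yes refl | no B≢D = when-no ((A Vec.++ B) ≟ᵥ (A Vec.++ D)) (B≢D ∘ proj₂ ∘ VP.++-injective A A) (+ 1)
... | no A≢C | _ = when-no ((A Vec.++ B) ≟ᵥ (C Vec.++ D)) (A≢C ∘ proj₁ ∘ VP.++-injective A C) (+ 1)

module _ (m k a d : ℕ) (a≤d : a ≤ d) where

  private
    n : ℕ
    n = m ℕ.+ k

  blockPairs : List (Vec ℕ m × Vec ℕ k)
  blockPairs = concatMap (λ A → map (A ,_) (partitions k (d ∸ a))) (partitions m a)

  ∑-blockPairs : (g : Vec ℕ m × Vec ℕ k → ℤ) →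
    ∑ blockPairs g ≡ ∑[ A ∈ partitions m a ] ∑[ B ∈ partitions k (d ∸ a) ] g (A , B)
  ∑-blockPairs g =
    trans (∑-concatMap (λ A → map (A ,_) (partitions k (d ∸ a))) (partitions m a) g)
     (∑-cong′ (partitions m a) (λ A → ∑-map (A ,_) (partitions k (d ∸ a)) g))

  blockPairs-sound : ∀ {x} → x ∈ blockPairs → proj₁ x ∈ partitions m a × proj₂ x ∈ partitions k (d ∸ a)
  blockPairs-sound {x} x∈ with find (∈-concatMap⁻ (λ A → map (A ,_) (partitions k (d ∸ a))) {xs = partitions m a} x∈)
  ... | A , A∈ , x∈′ with ∈-map⁻ (A ,_) x∈′
  ... | B , B∈ , refl = A∈ , B∈

  ∑-partitions-blocks : (g : Vec ℕ n → ℤ) →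
    (∀ ν → DecreasingV ν → Vec.sum ν ≡ d → ¬ Vec.sum (Vec.take m ν) ≡ a → g ν ≡ + 0) →
    ∑ (partitions n d) g ≡ ∑[ A ∈ partitions m a ] ∑[ B ∈ partitions k (d ∸ a) ] when (decreasing? (A Vec.++ B)) (g (A Vec.++ B))
  ∑-partitions-blocks g support =
    trans (∑-cong (partitions n d) (λ {ν} ν∈ → sym (when-yes (decreasing? ν) (proj₁ (partitions-sound n d ν ν∈)) (g ν))))
     (trans (sym (∑-reindex _≟ᵥ_ concat blockPairs (partitions n d) g′ once preimage))
      (∑-blockPairs (λ x → g′ (concat x))))
    where
    g′ : Vec ℕ n → ℤ
    g′ ν = when (decreasing? ν) (g ν)
    concat : Vec ℕ m × Vec ℕ k → Vec ℕ n
    concat (A , B) = A Vec.++ B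
    once : ∀ {x} → x ∈ blockPairs → ¬ g′ (concat x) ≡ + 0 → count _≟ᵥ_ (partitions n d) (concat x) ≡ + 1
    once {A , B} x∈ nz =
      let (A∈ , B∈) = blockPairs-sound x∈ in
      partitions-count n d (A Vec.++ B) (proj₁ (when-nonzero (decreasing? (A Vec.++ B)) _ nz))
        (trans (VP.sum-++ A) (trans (cong₂ ℕ._+_ (proj₂ (partitions-sound m a A A∈)) (proj₂ (partitions-sound k (d ∸ a) B B∈))) (ℕP.m+[n∸m]≡n a≤d)))
    preimage : ∀ {y} → y ∈ partitions n d → ¬ g′ y ≡ + 0 → ∑[ x ∈ blockPairs ] 𝟙 (concat x ≟ᵥ y) ≡ + 1
    preimage {y} y∈ nz =
      trans (∑-blockPairs (λ x → 𝟙 (concat x ≟ᵥ y)))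
       (trans (∑-cong′ (partitions m a) (λ A → trans (∑-cong′ (partitions k (d ∸ a)) (λ B → split A B))
                                                     (when-∑ (Vec.take m y ≟ᵥ A) (partitions k (d ∸ a)) _)))
        (trans (∑-cong′ (partitions m a) (λ A → cong (when (Vec.take m y ≟ᵥ A)) count-bottom))
         count-top))
      where
      y-dec : DecreasingV y × Vec.sum y ≡ d
      y-dec = partitions-sound n d y y∈
      y-blocks : DecreasingV (Vec.take m y) × DecreasingV (Vec.drop m y)
      y-blocks = DecreasingV-blocks m y (proj₁ y-dec)
      top-size : Vec.sum (Vec.take m y) ≡ a
      top-size with Vec.sum (Vec.take m y) ℕ.≟ a
      ... | yes e = e
      ... | no ne = ⊥-elim (proj₂ (when-nonzero (decreasing? y) (g y) nz) (support y (proj₁ y-dec) (proj₂ y-dec) ne))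
      split : ∀ A B → 𝟙 (concat (A , B) ≟ᵥ y) ≡ when (Vec.take m y ≟ᵥ A) (𝟙 (Vec.drop m y ≟ᵥ B))
      split A B = trans (when-⇔ (concat (A , B) ≟ᵥ y) ((Vec.take m y Vec.++ Vec.drop m y) ≟ᵥ (A Vec.++ B))
                                 (λ e → trans (VP.take++drop≡id m y) (sym e)) (λ e → trans (sym e) (VP.take++drop≡id m y)) (+ 1))
                        (𝟙-++ (Vec.take m y) A (Vec.drop m y) B)
      count-bottom : count _≟ᵥ_ (partitions k (d ∸ a)) (Vec.drop m y) ≡ + 1
      count-bottom = partitions-count k (d ∸ a) (Vec.drop m y) (proj₂ y-blocks)
        (trans (sym (ℕP.m+n∸m≡n (Vec.sum (Vec.take m y)) _)) (cong₂ _∸_ (trans (sym (sum-blocks m y)) (proj₂ y-dec)) top-size))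
      count-top : ∑[ A ∈ partitions m a ] when (Vec.take m y ≟ᵥ A) (+ 1) ≡ + 1
      count-top = partitions-count m a (Vec.take m y) (proj₁ y-blocks) top-size

  -- Paired with Schur coefficients at β ++ γ with |β| = a, a function g that
  -- vanishes when the top block exceeds a only sees top blocks of size a,
  -- where the Schur coefficient factors.
  ∑-schur-blocks : (g : Vec ℕ n → ℤ) →
    (∀ ν → DecreasingV ν → Vec.sum ν ≡ d → a < Vec.sum (Vec.take m ν) → g ν ≡ + 0) →
    ∀ (β : Vec ℕ m) (γ : Vec ℕ k) → Vec.sum β ≡ a →
    ∑[ ν ∈ partitions n d ] (g ν * schurCoeff ν (β Vec.++ γ))
      ≡ ∑[ A ∈ partitions m a ] ∑[ B ∈ partitions k (d ∸ a) ]
          (when (decreasing? (A Vec.++ B)) (g (A Vec.++ B)) * (schurCoeff A β * schurCoeff B γ))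
  ∑-schur-blocks g g-vanishes β γ β-size =
    trans (∑-cong (partitions n d) (λ {ν} ν∈ → only-top-size-a ν (partitions-sound n d ν ν∈)))
     (trans (∑-partitions-blocks G (λ ν _ _ ne → when-no (Vec.sum (Vec.take m ν) ℕ.≟ a) ne _))
      (∑-cong (partitions m a) (λ {A} A∈ → ∑-cong′ (partitions k (d ∸ a)) (λ B →
        trans (cong (when (decreasing? (A Vec.++ B))) (G-++ A B (proj₂ (partitions-sound m a A A∈))))
              (sym (when-*ʳ (decreasing? (A Vec.++ B)) (g (A Vec.++ B)) _))))))
    where
    G : Vec ℕ n → ℤ
    G ν = when (Vec.sum (Vec.take m ν) ℕ.≟ a) (g ν * (schurCoeff (Vec.take m ν) β * schurCoeff (Vec.drop m ν) γ))
    G-++ : ∀ A B → Vec.sum A ≡ a → G (A Vec.++ B) ≡ g (A Vec.++ B) * (schurCoeff A β * schurCoeff B γ)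
    G-++ A B A-size rewrite proj₁ (take-drop-++ A B) | proj₂ (take-drop-++ A B) = when-yes (Vec.sum A ℕ.≟ a) A-size _
    only-top-size-a : ∀ ν → DecreasingV ν × Vec.sum ν ≡ d → g ν * schurCoeff ν (β Vec.++ γ) ≡ G ν
    only-top-size-a ν (dec , ν-size) with Vec.sum (Vec.take m ν) ℕ.≟ a
    ... | yes top≡a =
      cong (g ν *_) (trans (cong (λ w → schurCoeff w (β Vec.++ γ)) (sym (VP.take++drop≡id m ν)))
                           (schurCoeff-++-factor (Vec.take m ν) β (Vec.drop m ν) γ (subst DecreasingV (sym (VP.take++drop≡id m ν)) dec) (trans β-size (sym top≡a))))
    ... | no top≢a with a ℕ.<? Vec.sum (Vec.take m ν)
    ...   | yes a<top = cong (_* schurCoeff ν (β Vec.++ γ)) (g-vanishes ν dec ν-size a<top)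
    ...   | no a≮top = trans (cong (g ν *_) K≡0) (ℤP.*-zeroʳ (g ν))
      where
      K≡0 : schurCoeff ν (β Vec.++ γ) ≡ + 0
      K≡0 with schurCoeff ν (β Vec.++ γ) ℤ.≟ + 0
      ... | yes z = z
      ... | no nz = ⊥-elim (top≢a (ℕP.≤-antisym (ℕP.≮⇒≥ a≮top) (subst (_≤ Vec.sum (Vec.take m ν)) β-size
              (schurCoeff-++-bound (Vec.take m ν) β (Vec.drop m ν) γ (subst DecreasingV (sym (VP.take++drop≡id m ν)) dec)
                 (λ e → nz (trans (cong (λ w → schurCoeff w (β Vec.++ γ)) (sym (VP.take++drop≡id m ν))) e))))))

downward-induction : ∀ (P : ℕ → Set) d → (∀ a → (∀ a′ → a < a′ → a′ ≤ d → P a′) → P a) → ∀ a → P a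
downward-induction P d step a = go (suc d) a (ℕP.m≤n+m (suc d) a)
  where
  go : ∀ j a → d < a ℕ.+ j → P a
  go zero a d<a+0 = step a (λ a′ a<a′ a′≤d →
    ⊥-elim (ℕP.<-irrefl refl (ℕP.≤-<-trans a′≤d (ℕP.<-trans (subst (d <_) (ℕP.+-identityʳ a) d<a+0) a<a′))))
  go (suc j) a d<a+1+j = step a (λ a′ a<a′ _ → go j a′ (ℕP.<-≤-trans d<a+1+j (subst (_≤ a′ ℕ.+ j) (sym (ℕP.+-suc a j)) (ℕP.+-monoˡ-≤ j a<a′))))

partitions-1 : ∀ x (A : Vec ℕ 1) → A ∈ partitions 1 x → A ≡ x ∷ []
partitions-1 x (y ∷ []) A∈ = cong (_∷ []) (trans (sym (ℕP.+-identityʳ y)) (proj₂ (partitions-sound 1 x (y ∷ []) A∈)))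

schurCoeff-1 : ∀ x → schurCoeff (x ∷ []) (x ∷ []) ≡ + 1
schurCoeff-1 x = trans (kostka-toList 1 (x ∷ []) (x ∷ [])) (trans (ℤP.+-identityʳ _) (when-yes (x ℕ.+ 0 ℕ.≟ x) (ℕP.+-identityʳ x) (+ 1)))

∑-schur-first-row : ∀ q d x → x ≤ d → (c : Vec ℕ (suc q) → ℤ) →
  (∀ ν → DecreasingV ν → Vec.sum ν ≡ d → x < Vec.head ν → c ν ≡ + 0) → ∀ (γ : Vec ℕ q) →
  ∑[ ν ∈ partitions (suc q) d ] (c ν * schurCoeff ν (x ∷ γ))
    ≡ ∑[ B ∈ partitions q (d ∸ x) ] (when (decreasing? (x ∷ B)) (c (x ∷ B)) * schurCoeff B γ)
∑-schur-first-row q d x x≤d c c-vanishes γ =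
  trans (∑-schur-blocks 1 q x d x≤d c (λ ν dec size lt → c-vanishes ν dec size (subst (x <_) (head-sum ν) lt)) (x ∷ []) γ (ℕP.+-identityʳ x))
   (trans (∑-single _≟ᵥ_ (partitions 1 x) (x ∷ []) H (λ A∈ A≢ → ⊥-elim (A≢ (partitions-1 x _ A∈))))
    (trans (cong (_* H (x ∷ [])) (partitions-count 1 x (x ∷ []) tt (ℕP.+-identityʳ x)))
     (trans (ℤP.*-identityˡ _)
      (∑-cong′ (partitions q (d ∸ x)) (λ B → cong (λ z → when (decreasing? (x ∷ B)) (c (x ∷ B)) * z)
                                                      (trans (cong (_* schurCoeff B γ) (schurCoeff-1 x)) (ℤP.*-identityˡ (schurCoeff B γ))))))))
  where
  head-sum : ∀ (ν : Vec ℕ (suc q)) → Vec.sum (Vec.take 1 ν) ≡ Vec.head ν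
  head-sum (y ∷ ν) = ℕP.+-identityʳ y
  H : Vec ℕ 1 → ℤ
  H A = ∑[ B ∈ partitions q (d ∸ x) ] (when (decreasing? (A Vec.++ B)) (c (A Vec.++ B)) * (schurCoeff A (x ∷ []) * schurCoeff B γ))

-- Schur polynomials are linearly independent (the Kostka matrix is
-- unitriangular): by induction on the number of parts and downward induction
-- on the first part.
schur-independent : ∀ p d (c : Vec ℕ p → ℤ) →
  (∀ α → Vec.sum α ≡ d → ∑[ ν ∈ partitions p d ] (c ν * schurCoeff ν α) ≡ + 0) →
  ∀ ν → DecreasingV ν → Vec.sum ν ≡ d → c ν ≡ + 0
schur-independent zero .0 c h [] _ refl = trans (sym (ℤP.*-identityʳ (c []))) (trans (sym (ℤP.+-identityʳ _)) (h [] refl))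
schur-independent (suc q) d c h (x ∷ B) = downward-induction FirstPart d step x B
  where
  FirstPart : ℕ → Set
  FirstPart x = ∀ B → DecreasingV (x ∷ B) → Vec.sum (x ∷ B) ≡ d → c (x ∷ B) ≡ + 0
  step : ∀ x → (∀ x′ → x < x′ → x′ ≤ d → FirstPart x′) → FirstPart x
  step x above B dec size =
    trans (sym (when-yes (decreasing? (x ∷ B)) dec (c (x ∷ B))))
     (schur-independent q (d ∸ x) c′ rest-vanishes B (proj₂ (DecreasingV-∷ x B dec))
       (trans (sym (ℕP.m+n∸m≡n x (Vec.sum B))) (cong (_∸ x) size)))
    where
    x≤d : x ≤ d
    x≤d = subst (x ≤_) size (ℕP.m≤m+n x (Vec.sum B))
    c′ : Vec ℕ q → ℤ
    c′ B = when (decreasing? (x ∷ B)) (c (x ∷ B))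
    higher-vanish : ∀ ν → DecreasingV ν → Vec.sum ν ≡ d → x < Vec.head ν → c ν ≡ + 0
    higher-vanish (y ∷ ν) dec size x<y = above y x<y (subst (y ≤_) size (ℕP.m≤m+n y (Vec.sum ν))) ν dec size
    rest-vanishes : ∀ γ → Vec.sum γ ≡ d ∸ x → ∑[ B ∈ partitions q (d ∸ x) ] (c′ B * schurCoeff B γ) ≡ + 0
    rest-vanishes γ γ-size =
      trans (sym (∑-schur-first-row q d x x≤d c higher-vanish γ))
            (h (x ∷ γ) (trans (cong (x ℕ.+_) γ-size) (ℕP.m+[n∸m]≡n x≤d)))

schur-independent₂ : ∀ m k a b (e : Vec ℕ m → Vec ℕ k → ℤ) →
  (∀ β γ → Vec.sum β ≡ a → Vec.sum γ ≡ b →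
     ∑[ A ∈ partitions m a ] ∑[ B ∈ partitions k b ] (e A B * (schurCoeff A β * schurCoeff B γ)) ≡ + 0) →
  ∀ A B → DecreasingV A → Vec.sum A ≡ a → DecreasingV B → Vec.sum B ≡ b → e A B ≡ + 0
schur-independent₂ m k a b e h A B decA sizeA decB sizeB = schur-independent k b (e A) in-y B decB sizeB
  where
  in-y : ∀ γ → Vec.sum γ ≡ b → ∑[ B ∈ partitions k b ] (e A B * schurCoeff B γ) ≡ + 0
  in-y γ γ-size = schur-independent m a (λ A → ∑[ B ∈ partitions k b ] (e A B * schurCoeff B γ)) in-x A decA sizeA
    where
    in-x : ∀ β → Vec.sum β ≡ a → ∑[ A ∈ partitions m a ] ((∑[ B ∈ partitions k b ] (e A B * schurCoeff B γ)) * schurCoeff A β) ≡ + 0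
    in-x β β-size =
      trans (∑-cong′ (partitions m a) (λ A → trans (sym (∑-*ʳ (partitions k b) (schurCoeff A β) (λ B → e A B * schurCoeff B γ)))
                                                  (∑-cong′ (partitions k b) (λ B → reorder (e A B) (schurCoeff B γ) (schurCoeff A β)))))
            (h β γ β-size γ-size)
      where
      reorder : ∀ x y z → x * y * z ≡ x * (z * y)
      reorder = solve-∀

-- Multiplying by (x₁⋯x_m)^c shifts Schur expansions:  s_μ · (x₁⋯x_m)^c = s_{μ+c}.

DecreasingL-addEach : ∀ c l → Decreasing l → Decreasing (addEach c l)
DecreasingL-addEach c [] _ = tt
DecreasingL-addEach c (a ∷ []) _ = tt
DecreasingL-addEach c (a ∷ b ∷ l) (b≤a , d) = ℕP.+-monoˡ-≤ c b≤a , DecreasingL-addEach c (b ∷ l) d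

DecreasingL-subEach : ∀ c l → Decreasing l → Decreasing (subEach c l)
DecreasingL-subEach c [] _ = tt
DecreasingL-subEach c (a ∷ []) _ = tt
DecreasingL-subEach c (a ∷ b ∷ l) (b≤a , d) = ℕP.∸-monoˡ-≤ c b≤a , DecreasingL-subEach c (b ∷ l) d

DecreasingV-+ᵥ : ∀ {m} c (μ : Vec ℕ m) → DecreasingV μ → DecreasingV (μ +ᵥ replicate m c)
DecreasingV-+ᵥ c μ d = subst Decreasing (sym (toList-+ᵥ c μ)) (DecreasingL-addEach c (toList μ) d)

DecreasingV-∸ᵥ : ∀ {m} c (μ : Vec ℕ m) → DecreasingV μ → DecreasingV (μ ∸ᵥ replicate m c)
DecreasingV-∸ᵥ c μ d = subst Decreasing (sym (toList-∸ᵥ c μ)) (DecreasingL-subEach c (toList μ) d)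

∑-partitions-+ᵥ : ∀ m c d W → d ℕ.+ m ℕ.* c ≡ W → (g : Vec ℕ m → ℤ) → (∀ {A} → ¬ g A ≡ + 0 → replicate m c ≤ᵥ A) →
  ∑[ μ ∈ partitions m d ] g (μ +ᵥ replicate m c) ≡ ∑ (partitions m W) g
∑-partitions-+ᵥ m c d W size g support = ∑-reindex _≟ᵥ_ (_+ᵥ C) (partitions m d) (partitions m W) g once preimage
  where
  C : Vec ℕ m
  C = replicate m c
  once : ∀ {μ} → μ ∈ partitions m d → ¬ g (μ +ᵥ C) ≡ + 0 → count _≟ᵥ_ (partitions m W) (μ +ᵥ C) ≡ + 1
  once {μ} μ∈ _ =
    let (dec , μ-size) = partitions-sound m d μ μ∈ in
    partitions-count m W (μ +ᵥ C) (DecreasingV-+ᵥ c μ dec) (trans (sum-+ᵥ μ C) (trans (cong₂ ℕ._+_ μ-size (sum-replicate m c)) size))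
  preimage : ∀ {A} → A ∈ partitions m W → ¬ g A ≡ + 0 → ∑[ μ ∈ partitions m d ] 𝟙 (μ +ᵥ C ≟ᵥ A) ≡ + 1
  preimage {A} A∈ nz =
    let C≤A = support nz ; (dec , A-size) = partitions-sound m W A A∈ in
    trans (∑-cong′ (partitions m d) (λ μ → when-⇔ (μ +ᵥ C ≟ᵥ A) (A ∸ᵥ C ≟ᵥ μ) (proj₁ (+ᵥC≡⇔ c μ A C≤A)) (proj₂ (+ᵥC≡⇔ c μ A C≤A)) (+ 1)))
          (partitions-count m d (A ∸ᵥ C) (DecreasingV-∸ᵥ c A dec)
            (ℕP.+-cancelʳ-≡ (m ℕ.* c) _ _ (trans (cong (Vec.sum (A ∸ᵥ C) ℕ.+_) (sym (sum-replicate m c))) (trans (sum-∸ᵥ C A C≤A) (trans A-size (sym size))))))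

raise-schur-expansion : ∀ m c (F cₘ : Vec ℕ m → ℤ) →
  (∀ α → F α ≡ ∑[ ν ∈ partitions m (Vec.sum α) ] (cₘ ν * schurCoeff ν α)) →
  ∀ W (β : Vec ℕ m) → Vec.sum β ≡ W →
  raise c F β ≡ ∑[ A ∈ partitions m W ] (raise c cₘ A * schurCoeff A β)
raise-schur-expansion m c F cₘ expansion W β β-size =
  sym (trans (∑-cong (partitions m W) (λ {A} A∈ → raised-term A (proj₁ (partitions-sound m W A A∈))))
             (by-cases (C ≤ᵥ? β)))
  where
  C : Vec ℕ m
  C = replicate m c
  raised-term : ∀ A → DecreasingV A → raise c cₘ A * schurCoeff A β ≡ when (C ≤ᵥ? A) (cₘ (A ∸ᵥ C) * raise c (schurCoeff (A ∸ᵥ C)) β)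
  raised-term A dec = trans (when-*ʳ (C ≤ᵥ? A) _ _) (when-cong (C ≤ᵥ? A) (λ C≤A →
    cong (cₘ (A ∸ᵥ C) *_) (trans (cong (λ w → schurCoeff w β) (sym (trans (+ᵥ-comm (A ∸ᵥ C) C) (+ᵥ-∸ᵥ C A C≤A))))
                                 (schurCoeff-+ᵥ m c (A ∸ᵥ C) β (DecreasingV-∸ᵥ c A dec)))))
  by-cases : (C≤β? : Dec (C ≤ᵥ β)) →
    ∑[ A ∈ partitions m W ] when (C ≤ᵥ? A) (cₘ (A ∸ᵥ C) * when C≤β? (schurCoeff (A ∸ᵥ C) (β ∸ᵥ C))) ≡ when C≤β? (F (β ∸ᵥ C))
  by-cases (no _) = ∑-zero (partitions m W) (λ {A} _ → when-zero (C ≤ᵥ? A) (λ _ → ℤP.*-zeroʳ (cₘ (A ∸ᵥ C))))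
  by-cases (yes C≤β) =
    sym (trans (expansion (β ∸ᵥ C))
         (trans (∑-cong′ (partitions m (Vec.sum (β ∸ᵥ C))) (λ μ → sym (shifted μ)))
          (∑-partitions-+ᵥ m c (Vec.sum (β ∸ᵥ C)) W (trans (cong (Vec.sum (β ∸ᵥ C) ℕ.+_) (sym (sum-replicate m c))) (trans (sum-∸ᵥ C β C≤β) β-size))
                           g (λ nz → proj₁ (when-nonzero (C ≤ᵥ? _) _ nz)))))
    where
    g : Vec ℕ m → ℤ
    g A = when (C ≤ᵥ? A) (cₘ (A ∸ᵥ C) * schurCoeff (A ∸ᵥ C) (β ∸ᵥ C))
    shifted : ∀ μ → g (μ +ᵥ C) ≡ cₘ μ * schurCoeff μ (β ∸ᵥ C)
    shifted μ = trans (when-yes (C ≤ᵥ? μ +ᵥ C) (C≤ᵥ+C c μ) _) (cong (λ ν → cₘ ν * schurCoeff ν (β ∸ᵥ C)) (∸ᵥ-+ᵥ-cancel μ C))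

module Factorization (m k : ℕ)
  (cₙ : Vec ℕ (m ℕ.+ k) → ℤ) (expansionₙ : IsSchurExpansion (m ℕ.+ k) (vandermonde (m ℕ.+ k) *P vandermonde (m ℕ.+ k)) cₙ)
  (cₘ : Vec ℕ m → ℤ) (expansionₘ : IsSchurExpansion m (vandermonde m *P vandermonde m) cₘ)
  (cₖ : Vec ℕ k → ℤ) (expansionₖ : IsSchurExpansion k (vandermonde k *P vandermonde k) cₖ) where

  private
    n W : ℕ
    n = m ℕ.+ k
    -- the top x-degree of a_{δ_n}²
    W = xdeg m k ℕ.+ xdeg m k

  blockCoeff : Vec ℕ m → Vec ℕ k → ℤ
  blockCoeff A B = when (decreasing? (A Vec.++ B)) (cₙ (A Vec.++ B))

  blockCoeff-split : ∀ ν → DecreasingV ν → blockCoeff (Vec.take m ν) (Vec.drop m ν) ≡ cₙ ν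
  blockCoeff-split ν dec =
    trans (when-yes (decreasing? _) (subst DecreasingV (sym (VP.take++drop≡id m ν)) dec) _) (cong cₙ (VP.take++drop≡id m ν))

  pairing : ∀ a d → a ≤ d → (∀ ν → DecreasingV ν → Vec.sum ν ≡ d → a < Vec.sum (Vec.take m ν) → cₙ ν ≡ + 0) →
    ∀ (β : Vec ℕ m) (γ : Vec ℕ k) → Vec.sum β ≡ a → Vec.sum γ ≡ d ∸ a →
    ∑[ A ∈ partitions m a ] ∑[ B ∈ partitions k (d ∸ a) ] (blockCoeff A B * (schurCoeff A β * schurCoeff B γ))
      ≡ square n (β Vec.++ γ)
  pairing a d a≤d higher β γ β-size γ-size =
    trans (sym (∑-schur-blocks m k a d a≤d cₙ higher β γ β-size))
     (trans (cong (λ s → ∑[ ν ∈ partitions n s ] (cₙ ν * schurCoeff ν (β Vec.++ γ)))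
                  (sym (trans (VP.sum-++ β) (trans (cong₂ ℕ._+_ β-size γ-size) (ℕP.m+[n∸m]≡n a≤d)))))
      (sym (expansionₙ (β Vec.++ γ))))

  top-vanishes : ∀ d ν → DecreasingV ν → Vec.sum ν ≡ d → W < Vec.sum (Vec.take m ν) → cₙ ν ≡ + 0
  top-vanishes d ν dec size = downward-induction TopSize d step (Vec.sum (Vec.take m ν)) ν dec size refl
    where
    TopSize : ℕ → Set
    TopSize a = ∀ ν → DecreasingV ν → Vec.sum ν ≡ d → Vec.sum (Vec.take m ν) ≡ a → W < a → cₙ ν ≡ + 0
    step : ∀ a → (∀ a′ → a < a′ → a′ ≤ d → TopSize a′) → TopSize a
    step a above ν dec size refl W<a =
      trans (sym (blockCoeff-split ν dec))
       (schur-independent₂ m k a (d ∸ a) blockCoeff square-vanishes (Vec.take m ν) (Vec.drop m ν) (proj₁ blocks) refl (proj₂ blocks) bottom-size)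
      where
      blocks : DecreasingV (Vec.take m ν) × DecreasingV (Vec.drop m ν)
      blocks = DecreasingV-blocks m ν dec
      top≤d : ∀ ν → Vec.sum ν ≡ d → Vec.sum (Vec.take m ν) ≤ d
      top≤d ν size = subst (_ ≤_) (trans (sym (sum-blocks m ν)) size) (ℕP.m≤m+n _ _)
      bottom-size : Vec.sum (Vec.drop m ν) ≡ d ∸ a
      bottom-size = trans (sym (ℕP.m+n∸m≡n a _)) (cong (_∸ a) (trans (sym (sum-blocks m ν)) size))
      higher : ∀ ν′ → DecreasingV ν′ → Vec.sum ν′ ≡ d → a < Vec.sum (Vec.take m ν′) → cₙ ν′ ≡ + 0
      higher ν′ dec′ size′ a<top = above _ a<top (top≤d ν′ size′) ν′ dec′ size′ refl (ℕP.<-trans W<a a<top)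
      square-vanishes : ∀ β γ → Vec.sum β ≡ a → Vec.sum γ ≡ d ∸ a →
        ∑[ A ∈ partitions m a ] ∑[ B ∈ partitions k (d ∸ a) ] (blockCoeff A B * (schurCoeff A β * schurCoeff B γ)) ≡ + 0
      square-vanishes β γ β-size γ-size =
        trans (pairing a d (top≤d ν size) higher β γ β-size γ-size) (square-split-vanishing m k β γ (subst (W <_) (sym β-size) W<a))

  top-factor : ∀ b A B → DecreasingV A → Vec.sum A ≡ W → DecreasingV B → Vec.sum B ≡ b →
    blockCoeff A B ≡ raise (k ℕ.+ k) cₘ A * cₖ B
  top-factor b A B decA sizeA decB sizeB =
    ℤP.i-j≡0⇒i≡j _ _ (schur-independent₂ m k W b (λ A B → blockCoeff A B - raise (k ℕ.+ k) cₘ A * cₖ B) difference-vanishes A B decA sizeA decB sizeB)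
    where
    K² : Vec ℕ m → Vec ℕ k → Vec ℕ m → Vec ℕ k → ℤ
    K² β γ A B = schurCoeff A β * schurCoeff B γ
    factor-out : ∀ x y z → (x - y) * z ≡ x * z - y * z
    factor-out = solve-∀
    interchange : ∀ a b c d → (a * c) * (b * d) ≡ (a * b) * (c * d)
    interchange = solve-∀
    -- both block functions pair to the coefficient of a_{δ_n}² at β ++ γ
    blockCoeff-pairing : ∀ β γ → Vec.sum β ≡ W → Vec.sum γ ≡ b →
      ∑[ A ∈ partitions m W ] ∑[ B ∈ partitions k b ] (blockCoeff A B * K² β γ A B) ≡ square n (β Vec.++ γ)
    blockCoeff-pairing β γ β-size γ-size =
      trans (cong (λ b′ → ∑[ A ∈ partitions m W ] ∑[ B ∈ partitions k b′ ] (blockCoeff A B * K² β γ A B)) (sym (ℕP.m+n∸m≡n W b)))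
            (pairing W (W ℕ.+ b) (ℕP.m≤m+n W b) (top-vanishes (W ℕ.+ b)) β γ β-size (trans γ-size (sym (ℕP.m+n∸m≡n W b))))
    product-pairing : ∀ β γ → Vec.sum β ≡ W → Vec.sum γ ≡ b →
      ∑[ A ∈ partitions m W ] ∑[ B ∈ partitions k b ] ((raise (k ℕ.+ k) cₘ A * cₖ B) * K² β γ A B) ≡ square n (β Vec.++ γ)
    product-pairing β γ β-size γ-size =
      sym (trans (square-split-top m k β γ β-size)
           (trans (cong₂ _*_ (raise-schur-expansion m (k ℕ.+ k) (square m) cₘ expansionₘ W β β-size)
                             (trans (expansionₖ γ) (cong (λ s → ∑[ B ∈ partitions k s ] (cₖ B * schurCoeff B γ)) γ-size)))
            (trans (∑-product (partitions m W) (partitions k b) _ _)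
             (∑-cong′ (partitions m W) (λ A → ∑-cong′ (partitions k b) (λ B →
               interchange (raise (k ℕ.+ k) cₘ A) (cₖ B) (schurCoeff A β) (schurCoeff B γ)))))))
    difference-vanishes : ∀ β γ → Vec.sum β ≡ W → Vec.sum γ ≡ b →
      ∑[ A ∈ partitions m W ] ∑[ B ∈ partitions k b ] ((blockCoeff A B - raise (k ℕ.+ k) cₘ A * cₖ B) * K² β γ A B) ≡ + 0
    difference-vanishes β γ β-size γ-size =
      trans (∑-cong′ (partitions m W) (λ A → trans (∑-cong′ (partitions k b) (λ B → factor-out (blockCoeff A B) (raise (k ℕ.+ k) cₘ A * cₖ B) (K² β γ A B)))
                                                    (∑-- (partitions k b) (λ B → blockCoeff A B * K² β γ A B) (λ B → (raise (k ℕ.+ k) cₘ A * cₖ B) * K² β γ A B))))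
       (trans (∑-- (partitions m W) _ _)
        (trans (cong₂ _-_ (blockCoeff-pairing β γ β-size γ-size) (product-pairing β γ β-size γ-size))
         (ℤP.+-inverseʳ (square n (β Vec.++ γ)))))

vdeg-double : ∀ m → vdeg (suc m) ℕ.+ vdeg (suc m) ≡ suc m ℕ.* m
vdeg-double zero = refl
vdeg-double (suc m) =
  trans (rearrange (suc m) (vdeg (suc m))) (trans (cong (suc m ℕ.+ suc m ℕ.+_) (vdeg-double m)) (square-step m))
  where
  rearrange : ∀ a v → a ℕ.+ v ℕ.+ (a ℕ.+ v) ≡ a ℕ.+ a ℕ.+ (v ℕ.+ v)
  rearrange = ℕSolver.solve-∀
  square-step : ∀ m → suc m ℕ.+ suc m ℕ.+ suc m ℕ.* m ≡ suc (suc m) ℕ.* suc m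
  square-step = ℕSolver.solve-∀

first-part : ∀ m k → 2 ℕ.* (suc m ℕ.+ k) ∸ suc m ∸ 1 ≡ m ℕ.+ (k ℕ.+ k)
first-part m k = trans (cong (λ t → t ∸ suc m ∸ 1) (rearrange m k)) (cong (_∸ 1) (ℕP.m+n∸m≡n (suc m) (suc (m ℕ.+ (k ℕ.+ k)))))
  where
  rearrange : ∀ m k → 2 ℕ.* (suc m ℕ.+ k) ≡ suc m ℕ.+ suc (m ℕ.+ (k ℕ.+ k))
  rearrange = ℕSolver.solve-∀

rectangle-size : ∀ m k → suc m ℕ.* (m ℕ.+ (k ℕ.+ k)) ≡ xdeg (suc m) k ℕ.+ xdeg (suc m) k
rectangle-size m k = trans (expand (suc m) m k) (trans (cong (λ t → t ℕ.+ (suc m ℕ.* k ℕ.+ suc m ℕ.* k)) (sym (vdeg-double m))) (regroup (vdeg (suc m)) (suc m ℕ.* k)))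
  where
  expand : ∀ a m k → a ℕ.* (m ℕ.+ (k ℕ.+ k)) ≡ a ℕ.* m ℕ.+ (a ℕ.* k ℕ.+ a ℕ.* k)
  expand = ℕSolver.solve-∀
  regroup : ∀ v x → v ℕ.+ v ℕ.+ (x ℕ.+ x) ≡ v ℕ.+ x ℕ.+ (v ℕ.+ x)
  regroup = ℕSolver.solve-∀

first-block : ∀ m k (λ' : Vec ℕ (suc m ℕ.+ k)) →
  Vec.take (suc m) λ' ≡ replicate (suc m) (2 ℕ.* (suc m ℕ.+ k) ∸ suc m ∸ 1) →
  Vec.take (suc m) λ' ≡ replicate (suc m) (m ℕ.+ (k ℕ.+ k)) × Vec.sum (Vec.take (suc m) λ') ≡ xdeg (suc m) k ℕ.+ xdeg (suc m) k
first-block m k λ' first-rows =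
  rectangle , trans (cong Vec.sum rectangle) (trans (sum-replicate (suc m) _) (rectangle-size m k))
  where
  rectangle : Vec.take (suc m) λ' ≡ replicate (suc m) (m ℕ.+ (k ℕ.+ k))
  rectangle = trans first-rows (cong (replicate (suc m)) (first-part m k))

raise-rectangle : ∀ m k (c : Vec ℕ (suc m) → ℤ) → raise (k ℕ.+ k) c (replicate (suc m) (m ℕ.+ (k ℕ.+ k))) ≡ c (replicate (suc m) m)
raise-rectangle m k c =
  trans (when-yes (replicate (suc m) (k ℕ.+ k) ≤ᵥ? replicate (suc m) (m ℕ.+ (k ℕ.+ k))) (replicate-≤ᵥ (suc m) (ℕP.m≤n+m (k ℕ.+ k) m)) _)
   (cong c (trans (VP.zipWith-replicate _∸_ (m ℕ.+ (k ℕ.+ k)) (k ℕ.+ k)) (cong (replicate (suc m)) (ℕP.m+n∸n≡m m (k ℕ.+ k)))))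

IsPartition⇒DecreasingV : ∀ {p} (ν : Vec ℕ p) → IsPartition ν → DecreasingV ν
IsPartition⇒DecreasingV [] _ = tt
IsPartition⇒DecreasingV (x ∷ []) _ = tt
IsPartition⇒DecreasingV (x ∷ y ∷ ν) part =
  part F.zero (F.suc F.zero) z≤n , IsPartition⇒DecreasingV (y ∷ ν) (λ i j i≤j → part (F.suc i) (F.suc j) (s≤s i≤j))

mainTheorem7 : (m k : ℕ) → 1 ≤ m →
    (λ' : Vec ℕ (m ℕ.+ k)) →
    IsPartition λ' →
    Vec.sum λ' ≡ (m ℕ.+ k) ℕ.* ((m ℕ.+ k) ∸ 1) →
    (m ℕ.+ k) ∸ 1 ≤ len λ' →
    Vec.take m λ' ≡ replicate m (2 ℕ.* (m ℕ.+ k) ∸ m ∸ 1) →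
    (cₙ : Vec ℕ (m ℕ.+ k) → ℤ) → IsSchurExpansion (m ℕ.+ k) (vandermonde (m ℕ.+ k) *P vandermonde (m ℕ.+ k)) cₙ →
    (cₘ : Vec ℕ m → ℤ) → IsSchurExpansion m (vandermonde m *P vandermonde m) cₘ →
    (cₖ : Vec ℕ k → ℤ) → IsSchurExpansion k (vandermonde k *P vandermonde k) cₖ →
    cₙ λ' ≡ cₘ (replicate m (m ∸ 1)) * cₖ (Vec.drop m λ')
mainTheorem7 (suc m) k _ λ' λ-partition _ _ first-rows cₙ expansionₙ cₘ expansionₘ cₖ expansionₖ =
  begin
    cₙ λ'                                                                  ≡⟨ sym (blockCoeff-split λ' λ-decreasing) ⟩
    blockCoeff (Vec.take (suc m) λ') (Vec.drop (suc m) λ')                ≡⟨ top-factor _ _ _ (proj₁ blocks) (proj₂ rectangle) (proj₂ blocks) refl ⟩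
    raise (k ℕ.+ k) cₘ (Vec.take (suc m) λ') * cₖ (Vec.drop (suc m) λ')   ≡⟨ cong (λ A → raise (k ℕ.+ k) cₘ A * cₖ (Vec.drop (suc m) λ')) (proj₁ rectangle) ⟩
    raise (k ℕ.+ k) cₘ (replicate (suc m) (m ℕ.+ (k ℕ.+ k))) * cₖ (Vec.drop (suc m) λ')
                                                                           ≡⟨ cong (_* cₖ (Vec.drop (suc m) λ')) (raise-rectangle m k cₘ) ⟩
    cₘ (replicate (suc m) m) * cₖ (Vec.drop (suc m) λ')                    ∎
  where
  open ≡-Reasoning
  open Factorization (suc m) k cₙ expansionₙ cₘ expansionₘ cₖ expansionₖ
  λ-decreasing : DecreasingV λ'
  λ-decreasing = IsPartition⇒DecreasingV λ' λ-partition
  blocks : DecreasingV (Vec.take (suc m) λ') × DecreasingV (Vec.drop (suc m) λ')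
  blocks = DecreasingV-blocks (suc m) λ' λ-decreasing
  rectangle : Vec.take (suc m) λ' ≡ replicate (suc m) (m ℕ.+ (k ℕ.+ k)) × Vec.sum (Vec.take (suc m) λ') ≡ xdeg (suc m) k ℕ.+ xdeg (suc m) k
  rectangle = first-block m k λ' first-rows
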